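{- Let $l=7$, $r\in\{1,2,3\}$, $a=[r]$, $b=[4r]$, $c=[2r]$. Then $p_{8,0}(1/a)=b^8c^8$ and $p_{8,2}(1/a)=(a^2+b^8)c^8$.
   Context: For an integer $i$, $[i]=\sum x^{n^2}\in\mathbb{Z}/2[[x]]$, summed over $n\in\mathbb{Z}$ with $n\equiv i\pmod 7$. $1/a$ is taken in the field $L$ of Laurent series over $\mathbb{Z}/2$. For $q$ a power of $2$ and $0\le j<q$, $p_{q,j}:L\to L$ is $\sum_n c_nx^n\mapsto\sum_{n\equiv j\pmod q}c_nx^n$. -}

module Defs where

open import Data.Bool using (Bool; true; false; _xor_; _∧_; if_then_else_)
open import Data.Nat as ℕ using (ℕ; zero; suc; _∸_; NonZero)
open import Data.Integer as ℤ using (ℤ; +_; _%ℕ_)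
open import Data.List using (List; map; foldr; upTo; filter; length)
open import Relation.Nullary.Decidable using (⌊_⌋)
open import Relation.Binary.PropositionalEquality using (_≡_)

-- Sum in ℤ/2 (represented by Bool, with + = xor, · = ∧) of a finite list
xsum : List Bool → Bool
xsum = foldr _xor_ false

-- Formal power series over ℤ/2: coefficient of x^n
PS : Set
PS = ℕ → Bool

intRange : ℕ → List ℤ
intRange m = map (λ j → (+ j) ℤ.- (+ m)) (upTo (suc (m ℕ.+ m)))

-- [i] = Σ_{n ∈ ℤ, n ≡ i (mod 7)} x^{n²}.  The coefficient of x^m is the parity of
-- #{ n ∈ ℤ : n ≡ i mod 7, n² = m }; every such n satisfies |n| ≤ m, so it
-- suffices to range over -m..m.
theta : ℤ → PS
theta i m = xsum (map (λ n → ⌊ ((n ℤ.- i) %ℕ 7) ℕ.≟ 0 ⌋ ∧ ⌊ (n ℤ.* n) ℤ.≟ (+ m) ⌋) (intRange m))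

-- Laurent series over ℤ/2: x^{-shift} · ser
record Laurent : Set where
  constructor laurent
  field
    shift : ℕ
    ser   : PS
open Laurent public

coeff : Laurent → ℤ → Bool
coeff f n with n ℤ.+ (+ shift f)
... | + k     = ser f k
... | ℤ.-[1+ _ ] = false

_≈L_ : Laurent → Laurent → Set
f ≈L g = ∀ n → coeff f n ≡ coeff g n
infix 4 _≈L_

ι : PS → Laurent
ι s = laurent 0 s

_*PS_ : PS → PS → PS
(s *PS t) n = xsum (map (λ i → s i ∧ t (n ∸ i)) (upTo (suc n)))

_+PS_ : PS → PS → PS
(s +PS t) n = s n xor t n

_*L_ : Laurent → Laurent → Laurent
f *L g = laurent (shift f ℕ.+ shift g) (ser f *PS ser g)
infixl 7 _*L_

padPS : ℕ → PS → PS
padPS k s n = if ⌊ k ℕ.≤? n ⌋ then s (n ∸ k) else false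

_+L_ : Laurent → Laurent → Laurent
f +L g = laurent (shift f ℕ.+ shift g)
                 (padPS (shift g) (ser f) +PS padPS (shift f) (ser g))
infixl 6 _+L_

oneL : Laurent
oneL = laurent 0 (λ { zero → true ; (suc _) → false })

_^L_ : Laurent → ℕ → Laurent
f ^L zero = oneL
f ^L suc k = f *L (f ^L k)

-- p_{q,j}: keep exactly the coefficients of x^n with n ≡ j (mod q)
proj : (q : ℕ) .{{_ : NonZero q}} → ℕ → Laurent → Laurent
proj q j f = laurent (shift f)
  (λ m → ⌊ (((+ m) ℤ.- (+ shift f)) %ℕ q) ℕ.≟ j ⌋ ∧ ser f m)

-- Over ℤ/2 squaring is the substitution x ↦ x², so a⁸ = a(x⁸) has only exponents divisible by 8
-- and p_{8,j}(1/a) = p_{8,j}(a⁷)/a⁸. Writing a⁷ = a·(a·a(x²))(x²) and splitting a into its even and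
-- odd parts, p_{8,0}(a⁷) and p_{8,2}(a⁷) are computed from three facts about a = [r], b = [4r],
-- c = [2r]: the even part of a is b(x⁴), since n² is even iff n = 2m, and 2m ≡ r iff m ≡ 4r (mod 7);
-- the odd part of a has exponents ≡ 1 (mod 4); and the even part of ab is (ac)(x²), because
-- (u, v) ↦ (v − u, −u − v) maps the representations k = u² + v² with u ≡ r, v ≡ 2r bijectively
-- onto the representations 2k = p² + q² with p ≡ r, q ≡ 4r.

module Submission where

open import Defs
open import Algebra.Bundles using (CommutativeSemiring; CommutativeRing)
open import Algebra.Structures.Biased using (IsCommutativeSemiringˡ)
import Algebra.Solver.Ring.NaturalCoefficients.Default as NaturalCoefficientsSolver
import Algebra.Properties.CommutativeSemigroup as CommutativeSemigroupProperties
open import Data.Bool using (Bool; true; false; _xor_; _∧_; not; if_then_else_)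
open import Data.Bool.Properties
  using (xor-assoc; xor-comm; xor-identityʳ; xor-same; ∧-assoc; ∧-comm; ∧-identityʳ; ∧-zeroʳ; ∧-idem;
         ∧-distribˡ-xor; ∧-distribʳ-xor; not-involutive; xor-∧-commutativeRing)
open import Data.Empty using (⊥-elim)
open import Data.Integer as ℤ using (ℤ; +_; -[1+_]; ∣_∣; _%ℕ_; _/ℕ_)
import Data.Integer.Properties as ℤₚ
open import Data.Integer.DivMod using (n%ℕd<d; a≡a%ℕn+[a/ℕn]*n)
import Data.Integer.Solver as ℤ-Solver
open import Data.Sign.Properties using (s*s≡+)
open import Data.List using (map; upTo; applyUpTo)
open import Data.List.Properties using (map-∘)
open import Data.Nat as ℕ using (ℕ; zero; suc; _∸_; _+_; _*_; _≤_; _<_; z≤n; s≤s; _≤?_; _<?_; _%_; NonZero)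
import Data.Nat.Properties as ℕₚ
open import Data.Nat.DivMod using (m≡m%n+[m/n]*n; m*n%n≡0; [m+kn]%n≡m%n; n%1≡0; %-congʳ; m%n%n≡m%n; %-distribˡ-+; m∣n⇒o%n%m≡o%m; m%n*o≡m*o%[n*o]; m%n<n)
open import Data.Nat.Divisibility using (_∣_; divides)
open import Data.Product using (Σ; _×_; _,_; proj₁; proj₂)
open import Data.Product.Properties using (≡-dec; ,-injective)
open import Data.Sum using (_⊎_; inj₁; inj₂)
open import Function.Bundles using (mk⇔)
open import Relation.Binary using (IsEquivalence)
open import Relation.Binary.Definitions using (DecidableEquality)
open import Relation.Binary.PropositionalEquality
import Relation.Binary.Reasoning.Setoid as SetoidReasoning
open import Relation.Nullary using (Dec; ¬_)
open import Relation.Nullary.Decidable using (⌊_⌋; yes; no; isYes≗does; dec-true; dec-false; does-⇔)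

open CommutativeSemigroupProperties (CommutativeRing.+-commutativeSemigroup xor-∧-commutativeRing)
  using (interchange)

-- Booleans and finite sums in ℤ/2

⌊⌋-true : ∀ {a} {A : Set a} (a? : Dec A) → A → ⌊ a? ⌋ ≡ true
⌊⌋-true a? a = trans (isYes≗does a?) (dec-true a? a)

⌊⌋-false : ∀ {a} {A : Set a} (a? : Dec A) → ¬ A → ⌊ a? ⌋ ≡ false
⌊⌋-false a? ¬a = trans (isYes≗does a?) (dec-false a? ¬a)

⌊⌋-sound : ∀ {a} {A : Set a} (a? : Dec A) → ⌊ a? ⌋ ≡ true → A
⌊⌋-sound (yes a) _ = a
⌊⌋-sound (no _) ()

⌊⌋-⇔ : ∀ {a b} {A : Set a} {B : Set b} (a? : Dec A) (b? : Dec B) → (A → B) → (B → A) → ⌊ a? ⌋ ≡ ⌊ b? ⌋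
⌊⌋-⇔ a? b? to from =
  trans (isYes≗does a?) (trans (does-⇔ (mk⇔ to from) a? b?) (sym (isYes≗does b?)))

∧-true : ∀ {x y} → x ∧ y ≡ true → x ≡ true × y ≡ true
∧-true {true} {true} _ = refl , refl

Bool-ext : ∀ {x y} → (x ≡ true → y ≡ true) → (y ≡ true → x ≡ true) → x ≡ y
Bool-ext {false} {false} _  _    = refl
Bool-ext {false} {true}  _  from = from refl
Bool-ext {true}  {false} to _    = sym (to refl)
Bool-ext {true}  {true}  _  _    = refl

xsumBelow : ℕ → (ℕ → Bool) → Bool
xsumBelow zero    f = false
xsumBelow (suc n) f = f 0 xor xsumBelow n (λ i → f (suc i))

xsum-applyUpTo : ∀ n (f : ℕ → ℕ) (g : ℕ → Bool) →
                 xsum (map g (applyUpTo f n)) ≡ xsumBelow n (λ i → g (f i))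
xsum-applyUpTo zero    f g = refl
xsum-applyUpTo (suc n) f g = cong (g (f 0) xor_) (xsum-applyUpTo n (λ i → f (suc i)) g)

xsum-upTo : ∀ n (g : ℕ → Bool) → xsum (map g (upTo n)) ≡ xsumBelow n g
xsum-upTo n = xsum-applyUpTo n (λ i → i)

xsumBelow-cong : ∀ n {f g} → (∀ i → i < n → f i ≡ g i) → xsumBelow n f ≡ xsumBelow n g
xsumBelow-cong zero    eq = refl
xsumBelow-cong (suc n) eq =
  cong₂ _xor_ (eq 0 (s≤s z≤n)) (xsumBelow-cong n (λ i i<n → eq (suc i) (s≤s i<n)))

xsumBelow-false : ∀ n {f} → (∀ i → i < n → f i ≡ false) → xsumBelow n f ≡ false
xsumBelow-false n eq = trans (xsumBelow-cong n eq) (all-false n)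
  where
  all-false : ∀ n → xsumBelow n (λ _ → false) ≡ false
  all-false zero    = refl
  all-false (suc n) = all-false n

xsumBelow-xor : ∀ n f g → xsumBelow n (λ i → f i xor g i) ≡ xsumBelow n f xor xsumBelow n g
xsumBelow-xor zero    f g = refl
xsumBelow-xor (suc n) f g =
  trans (cong ((f 0 xor g 0) xor_) (xsumBelow-xor n _ _)) (interchange (f 0) (g 0) _ _)

∧-distribˡ-xsumBelow : ∀ n b f → b ∧ xsumBelow n f ≡ xsumBelow n (λ i → b ∧ f i)
∧-distribˡ-xsumBelow zero    false f = refl
∧-distribˡ-xsumBelow zero    true  f = refl
∧-distribˡ-xsumBelow (suc n) b     f =
  trans (∧-distribˡ-xor b (f 0) _) (cong ((b ∧ f 0) xor_) (∧-distribˡ-xsumBelow n b _))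

xsumBelow-suc : ∀ n f → xsumBelow (suc n) f ≡ xsumBelow n f xor f n
xsumBelow-suc zero    f = xor-comm (f 0) false
xsumBelow-suc (suc n) f =
  trans (cong (f 0 xor_) (xsumBelow-suc n (λ i → f (suc i)))) (sym (xor-assoc (f 0) _ _))

xsumBelow-reverse : ∀ n f → xsumBelow (suc n) f ≡ xsumBelow (suc n) (λ i → f (n ∸ i))
xsumBelow-reverse zero    f = refl
xsumBelow-reverse (suc n) f = begin
    f 0 xor xsumBelow (suc n) (λ i → f (suc i))
  ≡⟨ cong (f 0 xor_) (xsumBelow-reverse n (λ i → f (suc i))) ⟩
    f 0 xor xsumBelow (suc n) (λ i → f (suc (n ∸ i)))
  ≡⟨ cong (f 0 xor_) (xsumBelow-cong (suc n) (λ i i<n → cong f (sym (ℕₚ.+-∸-assoc 1 (ℕₚ.≤-pred i<n))))) ⟩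
    f 0 xor xsumBelow (suc n) (λ i → f (suc n ∸ i))
  ≡⟨ xor-comm (f 0) _ ⟩
    xsumBelow (suc n) (λ i → f (suc n ∸ i)) xor f 0
  ≡⟨ cong (λ z → xsumBelow (suc n) (λ i → f (suc n ∸ i)) xor f z) (sym (ℕₚ.n∸n≡0 (suc n))) ⟩
    xsumBelow (suc n) (λ i → f (suc n ∸ i)) xor f (suc n ∸ suc n)
  ≡⟨ sym (xsumBelow-suc (suc n) (λ i → f (suc n ∸ i))) ⟩
    xsumBelow (suc (suc n)) (λ i → f (suc n ∸ i)) ∎
  where open ≡-Reasoning

xsumBelow-indicator : ∀ n k (X : ℕ → Bool) →
                      xsumBelow n (λ i → ⌊ i ℕ.≟ k ⌋ ∧ X i) ≡ ⌊ k <? n ⌋ ∧ X k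
xsumBelow-indicator zero    k       X = refl
xsumBelow-indicator (suc n) zero    X =
  trans (cong (X 0 xor_) (xsumBelow-false n (λ _ _ → refl))) (xor-identityʳ (X 0))
xsumBelow-indicator (suc n) (suc k) X = begin
    xsumBelow n (λ i → ⌊ suc i ℕ.≟ suc k ⌋ ∧ X (suc i))
  ≡⟨ xsumBelow-cong n (λ i _ → cong (_∧ X (suc i)) (⌊⌋-⇔ (suc i ℕ.≟ suc k) (i ℕ.≟ k) ℕₚ.suc-injective (cong suc))) ⟩
    xsumBelow n (λ i → ⌊ i ℕ.≟ k ⌋ ∧ X (suc i))
  ≡⟨ xsumBelow-indicator n k (λ i → X (suc i)) ⟩
    ⌊ k <? n ⌋ ∧ X (suc k)
  ≡⟨ cong (_∧ X (suc k)) (⌊⌋-⇔ (k <? n) (suc k <? suc n) s≤s ℕₚ.≤-pred) ⟩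
    ⌊ suc k <? suc n ⌋ ∧ X (suc k) ∎
  where open ≡-Reasoning

-- The semiring of power series over ℤ/2

infix 4 _≐_
_≐_ : PS → PS → Set
s ≐ t = ∀ n → s n ≡ t n

0ₛ : PS
0ₛ _ = false

1ₛ : PS
1ₛ = ser oneL

tail : PS → PS
tail s n = s (suc n)

scale : Bool → PS → PS
scale b s n = b ∧ s n

*PS-coeff : ∀ s t n → (s *PS t) n ≡ xsumBelow (suc n) (λ i → s i ∧ t (n ∸ i))
*PS-coeff s t n = xsum-upTo (suc n) (λ i → s i ∧ t (n ∸ i))

*PS-coeff-0 : ∀ s t → (s *PS t) 0 ≡ s 0 ∧ t 0
*PS-coeff-0 s t = trans (*PS-coeff s t 0) (xor-identityʳ _)

tail-*PS : ∀ s t → tail (s *PS t) ≐ scale (s 0) (tail t) +PS (tail s *PS t)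
tail-*PS s t n =
  trans (*PS-coeff s t (suc n)) (cong ((s 0 ∧ t (suc n)) xor_) (sym (*PS-coeff (tail s) t n)))

*PS-cong : ∀ {s s′ t t′} → s ≐ s′ → t ≐ t′ → s *PS t ≐ s′ *PS t′
*PS-cong {s} {s′} {t} {t′} s≐s′ t≐t′ n = begin
    (s *PS t) n
  ≡⟨ *PS-coeff s t n ⟩
    xsumBelow (suc n) (λ i → s i ∧ t (n ∸ i))
  ≡⟨ xsumBelow-cong (suc n) (λ i _ → cong₂ _∧_ (s≐s′ i) (t≐t′ (n ∸ i))) ⟩
    xsumBelow (suc n) (λ i → s′ i ∧ t′ (n ∸ i))
  ≡⟨ sym (*PS-coeff s′ t′ n) ⟩
    (s′ *PS t′) n ∎
  where open ≡-Reasoning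

*PS-comm : ∀ s t → s *PS t ≐ t *PS s
*PS-comm s t n = begin
    (s *PS t) n
  ≡⟨ *PS-coeff s t n ⟩
    xsumBelow (suc n) (λ i → s i ∧ t (n ∸ i))
  ≡⟨ xsumBelow-reverse n (λ i → s i ∧ t (n ∸ i)) ⟩
    xsumBelow (suc n) (λ i → s (n ∸ i) ∧ t (n ∸ (n ∸ i)))
  ≡⟨ xsumBelow-cong (suc n) (λ i i≤n → trans (∧-comm (s (n ∸ i)) _)
       (cong (λ j → t j ∧ s (n ∸ i)) (ℕₚ.m∸[m∸n]≡n (ℕₚ.≤-pred i≤n)))) ⟩
    xsumBelow (suc n) (λ i → t i ∧ s (n ∸ i))
  ≡⟨ sym (*PS-coeff t s n) ⟩
    (t *PS s) n ∎
  where open ≡-Reasoning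

*PS-distribʳ : ∀ u s t → (s +PS t) *PS u ≐ (s *PS u) +PS (t *PS u)
*PS-distribʳ u s t n = begin
    ((s +PS t) *PS u) n
  ≡⟨ *PS-coeff (s +PS t) u n ⟩
    xsumBelow (suc n) (λ i → (s i xor t i) ∧ u (n ∸ i))
  ≡⟨ xsumBelow-cong (suc n) (λ i _ → ∧-distribʳ-xor (u (n ∸ i)) (s i) (t i)) ⟩
    xsumBelow (suc n) (λ i → (s i ∧ u (n ∸ i)) xor (t i ∧ u (n ∸ i)))
  ≡⟨ xsumBelow-xor (suc n) (λ i → s i ∧ u (n ∸ i)) (λ i → t i ∧ u (n ∸ i)) ⟩
    xsumBelow (suc n) (λ i → s i ∧ u (n ∸ i)) xor xsumBelow (suc n) (λ i → t i ∧ u (n ∸ i))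
  ≡⟨ sym (cong₂ _xor_ (*PS-coeff s u n) (*PS-coeff t u n)) ⟩
    ((s *PS u) +PS (t *PS u)) n ∎
  where open ≡-Reasoning

scale-*PS : ∀ b s t → scale b s *PS t ≐ scale b (s *PS t)
scale-*PS b s t n = begin
    (scale b s *PS t) n
  ≡⟨ *PS-coeff (scale b s) t n ⟩
    xsumBelow (suc n) (λ i → (b ∧ s i) ∧ t (n ∸ i))
  ≡⟨ xsumBelow-cong (suc n) (λ i _ → ∧-assoc b (s i) (t (n ∸ i))) ⟩
    xsumBelow (suc n) (λ i → b ∧ (s i ∧ t (n ∸ i)))
  ≡⟨ sym (∧-distribˡ-xsumBelow (suc n) b (λ i → s i ∧ t (n ∸ i))) ⟩
    b ∧ xsumBelow (suc n) (λ i → s i ∧ t (n ∸ i))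
  ≡⟨ cong (b ∧_) (sym (*PS-coeff s t n)) ⟩
    scale b (s *PS t) n ∎
  where open ≡-Reasoning

*PS-assoc : ∀ s t u → (s *PS t) *PS u ≐ s *PS (t *PS u)
*PS-assoc s t u zero = begin
    ((s *PS t) *PS u) 0
  ≡⟨ trans (*PS-coeff-0 (s *PS t) u) (cong (_∧ u 0) (*PS-coeff-0 s t)) ⟩
    (s 0 ∧ t 0) ∧ u 0
  ≡⟨ ∧-assoc (s 0) (t 0) (u 0) ⟩
    s 0 ∧ (t 0 ∧ u 0)
  ≡⟨ sym (trans (*PS-coeff-0 s (t *PS u)) (cong (s 0 ∧_) (*PS-coeff-0 t u))) ⟩
    (s *PS (t *PS u)) 0 ∎
  where open ≡-Reasoning
*PS-assoc s t u (suc n) = begin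
    ((s *PS t) *PS u) (suc n)
  ≡⟨ tail-*PS (s *PS t) u n ⟩
    ((s *PS t) 0 ∧ u (suc n)) xor (tail (s *PS t) *PS u) n
  ≡⟨ cong₂ (λ x y → (x ∧ u (suc n)) xor y) (*PS-coeff-0 s t)
       (*PS-cong {t = u} (tail-*PS s t) (λ _ → refl) n) ⟩
    ((s 0 ∧ t 0) ∧ u (suc n)) xor ((scale (s 0) (tail t) +PS (tail s *PS t)) *PS u) n
  ≡⟨ cong (((s 0 ∧ t 0) ∧ u (suc n)) xor_) (*PS-distribʳ u (scale (s 0) (tail t)) (tail s *PS t) n) ⟩
    ((s 0 ∧ t 0) ∧ u (suc n)) xor ((scale (s 0) (tail t) *PS u) n xor ((tail s *PS t) *PS u) n)
  ≡⟨ cong₂ (λ x y → ((s 0 ∧ t 0) ∧ u (suc n)) xor (x xor y))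
       (scale-*PS (s 0) (tail t) u n) (*PS-assoc (tail s) t u n) ⟩
    ((s 0 ∧ t 0) ∧ u (suc n)) xor ((s 0 ∧ (tail t *PS u) n) xor (tail s *PS (t *PS u)) n)
  ≡⟨ sym (xor-assoc ((s 0 ∧ t 0) ∧ u (suc n)) (s 0 ∧ (tail t *PS u) n) ((tail s *PS (t *PS u)) n)) ⟩
    (((s 0 ∧ t 0) ∧ u (suc n)) xor (s 0 ∧ (tail t *PS u) n)) xor (tail s *PS (t *PS u)) n
  ≡⟨ cong (_xor (tail s *PS (t *PS u)) n)
       (trans (cong (_xor (s 0 ∧ (tail t *PS u) n)) (∧-assoc (s 0) (t 0) _)) (sym (∧-distribˡ-xor (s 0) _ _))) ⟩
    (s 0 ∧ ((t 0 ∧ u (suc n)) xor (tail t *PS u) n)) xor (tail s *PS (t *PS u)) n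
  ≡⟨ cong (λ x → (s 0 ∧ x) xor (tail s *PS (t *PS u)) n) (sym (tail-*PS t u n)) ⟩
    (s 0 ∧ (t *PS u) (suc n)) xor (tail s *PS (t *PS u)) n
  ≡⟨ sym (tail-*PS s (t *PS u) n) ⟩
    (s *PS (t *PS u)) (suc n) ∎
  where open ≡-Reasoning

*PS-identityˡ : ∀ s → 1ₛ *PS s ≐ s
*PS-identityˡ s n =
  trans (*PS-coeff 1ₛ s n) (trans (cong (s n xor_) (xsumBelow-false n (λ _ _ → refl))) (xor-identityʳ _))

*PS-zeroˡ : ∀ s → 0ₛ *PS s ≐ 0ₛ
*PS-zeroˡ s n = trans (*PS-coeff 0ₛ s n) (xsumBelow-false (suc n) (λ _ _ → refl))

≐-isEquivalence : IsEquivalence _≐_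
≐-isEquivalence = record
  { refl = λ _ → refl ; sym = λ eq n → sym (eq n) ; trans = λ eq eq′ n → trans (eq n) (eq′ n) }

powerSeries : CommutativeSemiring _ _
powerSeries = record
  { Carrier = PS ; _≈_ = _≐_ ; _+_ = _+PS_ ; _*_ = _*PS_ ; 0# = 0ₛ ; 1# = 1ₛ
  ; isCommutativeSemiring = IsCommutativeSemiringˡ.isCommutativeSemiring (record
     { +-isCommutativeMonoid = record
        { isMonoid = record
           { isSemigroup = record
              { isMagma = record { isEquivalence = ≐-isEquivalence ; ∙-cong = λ eq eq′ n → cong₂ _xor_ (eq n) (eq′ n) }
              ; assoc = λ s t u n → xor-assoc (s n) (t n) (u n) }
           ; identity = (λ _ _ → refl) , (λ s n → xor-identityʳ (s n)) }
        ; comm = λ s t n → xor-comm (s n) (t n) }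
     ; *-isCommutativeMonoid = record
        { isMonoid = record
           { isSemigroup = record
              { isMagma = record { isEquivalence = ≐-isEquivalence ; ∙-cong = *PS-cong }
              ; assoc = *PS-assoc }
           ; identity = *PS-identityˡ , (λ s n → trans (*PS-comm s 1ₛ n) (*PS-identityˡ s n)) }
        ; comm = *PS-comm }
     ; distribʳ = *PS-distribʳ
     ; zeroˡ = *PS-zeroˡ })
  }

open CommutativeSemiring powerSeries
  using () renaming (refl to ≐-refl; sym to ≐-sym; trans to ≐-trans; *-congˡ to *PS-congˡ; *-congʳ to *PS-congʳ)
module ≐-Reasoning = SetoidReasoning (CommutativeSemiring.setoid powerSeries)
module PS-Solver = NaturalCoefficientsSolver powerSeries

-- Frobenius

data Parity : ℕ → Set where
  even : ∀ k → Parity (2 * k)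
  odd  : ∀ k → Parity (suc (2 * k))

parity : ∀ n → Parity n
parity zero = even 0
parity (suc n) with parity n
... | even k = odd k
... | odd  k = subst Parity (ℕₚ.*-suc 2 k) (even (suc k))

stretch : PS → PS
stretch s zero                = s 0
stretch s (suc zero)          = false
stretch s (suc (suc n))       = stretch (tail s) n

stretch-even : ∀ s k → stretch s (2 * k) ≡ s k
stretch-even s zero    = refl
stretch-even s (suc k) = trans (cong (stretch s) (ℕₚ.*-suc 2 k)) (stretch-even (tail s) k)

stretch-odd : ∀ s k → stretch s (suc (2 * k)) ≡ false
stretch-odd s zero    = refl
stretch-odd s (suc k) = trans (cong (λ n → stretch s (suc n)) (ℕₚ.*-suc 2 k)) (stretch-odd (tail s) k)

stretch-cong : ∀ {s t} → s ≐ t → stretch s ≐ stretch t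
stretch-cong {s} {t} s≐t n with parity n
... | even k = trans (stretch-even s k) (trans (s≐t k) (sym (stretch-even t k)))
... | odd  k = trans (stretch-odd s k) (sym (stretch-odd t k))

stretch-+ : ∀ s t → stretch (s +PS t) ≐ stretch s +PS stretch t
stretch-+ s t n with parity n
... | even k = trans (stretch-even (s +PS t) k) (sym (cong₂ _xor_ (stretch-even s k) (stretch-even t k)))
... | odd  k = trans (stretch-odd (s +PS t) k) (sym (cong₂ _xor_ (stretch-odd s k) (stretch-odd t k)))

middleTerm : ℕ → (ℕ → ℕ → Bool) → Bool
middleTerm zero          h = h 0 0
middleTerm (suc zero)    h = false
middleTerm (suc (suc n)) h = middleTerm n (λ i j → h (suc i) (suc j))

-- For symmetric h the terms i and n ∸ i cancel in pairs; only the middle term survives.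
xsumBelow-symmetric : ∀ n (h : ℕ → ℕ → Bool) → (∀ i j → h i j ≡ h j i) →
                      xsumBelow (suc n) (λ i → h i (n ∸ i)) ≡ middleTerm n h
xsumBelow-symmetric zero          h symm = xor-identityʳ _
xsumBelow-symmetric (suc zero)    h symm =
  trans (cong (h 0 1 xor_) (trans (xor-identityʳ _) (symm 1 0))) (xor-same (h 0 1))
xsumBelow-symmetric (suc (suc n)) h symm = begin
    h 0 (2 + n) xor xsumBelow (suc (suc n)) (λ i → h (suc i) (suc n ∸ i))
  ≡⟨ cong (h 0 (2 + n) xor_) (xsumBelow-suc (suc n) (λ i → h (suc i) (suc n ∸ i))) ⟩
    h 0 (2 + n) xor (inner xor h (2 + n) (suc n ∸ suc n))
  ≡⟨ cong (λ z → h 0 (2 + n) xor (inner xor z)) (trans (cong (h (2 + n)) (ℕₚ.n∸n≡0 n)) (symm (2 + n) 0)) ⟩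
    h 0 (2 + n) xor (inner xor h 0 (2 + n))
  ≡⟨ cancel (h 0 (2 + n)) inner ⟩
    inner
  ≡⟨ xsumBelow-cong (suc n) (λ i i≤n → cong (h (suc i)) (ℕₚ.+-∸-assoc 1 (ℕₚ.≤-pred i≤n))) ⟩
    xsumBelow (suc n) (λ i → h (suc i) (suc (n ∸ i)))
  ≡⟨ xsumBelow-symmetric n (λ i j → h (suc i) (suc j)) (λ i j → symm (suc i) (suc j)) ⟩
    middleTerm (2 + n) h ∎
  where
  open ≡-Reasoning
  inner = xsumBelow (suc n) (λ i → h (suc i) (suc n ∸ i))
  cancel : ∀ x y → x xor (y xor x) ≡ y
  cancel false y = xor-identityʳ y
  cancel true  y = trans (cong not (xor-comm y true)) (not-involutive y)

middleTerm-square : ∀ n s → middleTerm n (λ i j → s i ∧ s j) ≡ stretch s n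
middleTerm-square zero          s = ∧-idem (s 0)
middleTerm-square (suc zero)    s = refl
middleTerm-square (suc (suc n)) s = middleTerm-square n (tail s)

frobenius : ∀ s → s *PS s ≐ stretch s
frobenius s n = begin
    (s *PS s) n
  ≡⟨ *PS-coeff s s n ⟩
    xsumBelow (suc n) (λ i → s i ∧ s (n ∸ i))
  ≡⟨ xsumBelow-symmetric n (λ i j → s i ∧ s j) (λ i j → ∧-comm (s i) (s j)) ⟩
    middleTerm n (λ i j → s i ∧ s j)
  ≡⟨ middleTerm-square n s ⟩
    stretch s n ∎
  where open ≡-Reasoning

-- Residue classes of exponents

restrictBy : (ℕ → Bool) → PS → PS
restrictBy π s n = π n ∧ s n

select : (q : ℕ) .{{_ : NonZero q}} → ℕ → PS → PS
select q j = restrictBy (λ n → ⌊ n % q ℕ.≟ j ⌋)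

SupportedIn : (q : ℕ) .{{_ : NonZero q}} → ℕ → PS → Set
SupportedIn q ρ s = ∀ n → s n ≡ true → n % q ≡ ρ

restrictBy-cong : ∀ π {s t} → s ≐ t → restrictBy π s ≐ restrictBy π t
restrictBy-cong π s≐t n = cong (π n ∧_) (s≐t n)

select-cong : ∀ q .{{_ : NonZero q}} j {s t} → s ≐ t → select q j s ≐ select q j t
select-cong q j = restrictBy-cong _

select-+ : ∀ q .{{_ : NonZero q}} j s t → select q j (s +PS t) ≐ select q j s +PS select q j t
select-+ q j s t n = ∧-distribˡ-xor _ (s n) (t n)

select-supported : ∀ q .{{_ : NonZero q}} ρ s → SupportedIn q ρ s → select q ρ s ≐ s
select-supported q ρ s supp n with s n in eq
... | false = ∧-zeroʳ _
... | true  = cong (_∧ true) (⌊⌋-true (n % q ℕ.≟ ρ) (supp n eq))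

select-supportedIn : ∀ q .{{_ : NonZero q}} j s → SupportedIn q j (select q j s)
select-supportedIn q j s n eq = ⌊⌋-sound (n % q ℕ.≟ j) (proj₁ (∧-true eq))

select-select : ∀ q .{{_ : NonZero q}} q′ .{{_ : NonZero q′}} → q ∣ q′ → ∀ j j₀ → j % q ≡ j₀ → ∀ s →
                select q′ j (select q j₀ s) ≐ select q′ j s
select-select q q′ q∣q′ j j₀ j≡j₀ s n with n % q′ ℕ.≟ j
... | no  _ = refl
... | yes n≡j = cong (_∧ s n) (⌊⌋-true (n % q ℕ.≟ j₀)
                  (trans (sym (m∣n⇒o%n%m≡o%m q q′ n q∣q′)) (trans (cong (_% q) n≡j) j≡j₀)))

evenPart+oddPart : ∀ s → s ≐ select 2 0 s +PS select 2 1 s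
evenPart+oddPart s n with n % 2 | m%n<n n 2
... | 0 | _ = sym (xor-identityʳ (s n))
... | 1 | _ = refl
... | suc (suc _) | s≤s (s≤s ())

%-of-sum : ∀ q .{{_ : NonZero q}} i n → i ≤ n → n % q ≡ (i % q + (n ∸ i) % q) % q
%-of-sum q i n i≤n = trans (cong (_% q) (sym (ℕₚ.m+[n∸m]≡n i≤n))) (%-distribˡ-+ i (n ∸ i) q)

Periodic : (q : ℕ) .{{_ : NonZero q}} → (ℕ → Bool) → Set
Periodic q π = ∀ i n → i ≤ n → (n ∸ i) % q ≡ 0 → π n ≡ π i

restrictBy-*PS : ∀ q .{{_ : NonZero q}} π g h → Periodic q π → SupportedIn q 0 h →
                 restrictBy π (g *PS h) ≐ restrictBy π g *PS h
restrictBy-*PS q π g h periodic supp n = begin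
    π n ∧ (g *PS h) n
  ≡⟨ cong (π n ∧_) (*PS-coeff g h n) ⟩
    π n ∧ xsumBelow (suc n) (λ i → g i ∧ h (n ∸ i))
  ≡⟨ ∧-distribˡ-xsumBelow (suc n) (π n) (λ i → g i ∧ h (n ∸ i)) ⟩
    xsumBelow (suc n) (λ i → π n ∧ (g i ∧ h (n ∸ i)))
  ≡⟨ xsumBelow-cong (suc n) (λ i i≤n → term i (ℕₚ.≤-pred i≤n)) ⟩
    xsumBelow (suc n) (λ i → (π i ∧ g i) ∧ h (n ∸ i))
  ≡⟨ sym (*PS-coeff (restrictBy π g) h n) ⟩
    (restrictBy π g *PS h) n ∎
  where
  open ≡-Reasoning
  term : ∀ i → i ≤ n → π n ∧ (g i ∧ h (n ∸ i)) ≡ (π i ∧ g i) ∧ h (n ∸ i)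
  term i i≤n with h (n ∸ i) in hₙ₋ᵢ
  ... | false = trans (cong (π n ∧_) (∧-zeroʳ (g i))) (trans (∧-zeroʳ _) (sym (∧-zeroʳ _)))
  ... | true  = trans (cong (_∧ (g i ∧ true)) (periodic i n i≤n (supp (n ∸ i) hₙ₋ᵢ))) (sym (∧-assoc _ (g i) true))

select-periodic : ∀ q .{{_ : NonZero q}} j → Periodic q (λ n → ⌊ n % q ℕ.≟ j ⌋)
select-periodic q j i n i≤n n∸i≡0 = cong (λ r → ⌊ r ℕ.≟ j ⌋)
  (trans (%-of-sum q i n i≤n)
  (trans (cong (λ r → (i % q + r) % q) n∸i≡0)
  (trans (cong (_% q) (ℕₚ.+-identityʳ (i % q))) (m%n%n≡m%n i q))))

select-*PS-supported₀ : ∀ q .{{_ : NonZero q}} j g h → SupportedIn q 0 h →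
                        select q j (g *PS h) ≐ select q j g *PS h
select-*PS-supported₀ q j g h = restrictBy-*PS q _ g h (select-periodic q j)

select-*PS-outside : ∀ q .{{_ : NonZero q}} ρ σ j g h → SupportedIn q ρ g → SupportedIn q σ h →
                   (ρ + σ) % q ≢ j → select q j (g *PS h) ≐ 0ₛ
select-*PS-outside q ρ σ j g h supp-g supp-h ρ+σ≢j n = begin
    ⌊ n % q ℕ.≟ j ⌋ ∧ (g *PS h) n
  ≡⟨ cong (⌊ n % q ℕ.≟ j ⌋ ∧_) (*PS-coeff g h n) ⟩
    ⌊ n % q ℕ.≟ j ⌋ ∧ xsumBelow (suc n) (λ i → g i ∧ h (n ∸ i))
  ≡⟨ ∧-distribˡ-xsumBelow (suc n) _ (λ i → g i ∧ h (n ∸ i)) ⟩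
    xsumBelow (suc n) (λ i → ⌊ n % q ℕ.≟ j ⌋ ∧ (g i ∧ h (n ∸ i)))
  ≡⟨ xsumBelow-false (suc n) (λ i i≤n → term i (ℕₚ.≤-pred i≤n)) ⟩
    false ∎
  where
  open ≡-Reasoning
  term : ∀ i → i ≤ n → ⌊ n % q ℕ.≟ j ⌋ ∧ (g i ∧ h (n ∸ i)) ≡ false
  term i i≤n with g i in gᵢ | h (n ∸ i) in hₙ₋ᵢ
  ... | false | _     = ∧-zeroʳ _
  ... | true  | false = ∧-zeroʳ _
  ... | true  | true  = trans (∧-identityʳ _) (⌊⌋-false (n % q ℕ.≟ j) (λ n%q≡j → ρ+σ≢j (begin
          (ρ + σ) % q
        ≡⟨ cong₂ (λ x y → (x + y) % q) (sym (supp-g i gᵢ)) (sym (supp-h (n ∸ i) hₙ₋ᵢ)) ⟩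
          (i % q + (n ∸ i) % q) % q
        ≡⟨ sym (%-of-sum q i n i≤n) ⟩
          n % q
        ≡⟨ n%q≡j ⟩
          j ∎)))

double-% : ∀ q .{{_ : NonZero q}} q′ .{{_ : NonZero q′}} → q * 2 ≡ q′ → ∀ k → (2 * k) % q′ ≡ (k % q) * 2
double-% q q′ q′≡ k = begin
    (2 * k) % q′
  ≡⟨ cong (_% q′) (ℕₚ.*-comm 2 k) ⟩
    (k * 2) % q′
  ≡⟨ %-congʳ {{_}} {{ℕₚ.m*n≢0 q 2}} (sym q′≡) ⟩
    _%_ (k * 2) (q * 2) {{ℕₚ.m*n≢0 q 2}}
  ≡⟨ sym (m%n*o≡m*o%[n*o] k q 2 {{_}} {{ℕₚ.m*n≢0 q 2}}) ⟩
    (k % q) * 2 ∎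
  where open ≡-Reasoning

stretch-supportedIn : ∀ q .{{_ : NonZero q}} q′ .{{_ : NonZero q′}} → q * 2 ≡ q′ → ∀ ρ s →
                      SupportedIn q ρ s → SupportedIn q′ (ρ * 2) (stretch s)
stretch-supportedIn q q′ q′≡ ρ s supp n eq with parity n
... | even k = trans (double-% q q′ q′≡ k) (cong (_* 2) (supp k (trans (sym (stretch-even s k)) eq)))
... | odd  k with () ← trans (sym (stretch-odd s k)) eq

select-stretch : ∀ q .{{_ : NonZero q}} q′ .{{_ : NonZero q′}} → q * 2 ≡ q′ → ∀ j j′ → j * 2 ≡ j′ → ∀ g →
                 select q′ j′ (stretch g) ≐ stretch (select q j g)
select-stretch q q′ q′≡ j j′ j′≡ g n with parity n
... | even k = begin
    ⌊ (2 * k) % q′ ℕ.≟ j′ ⌋ ∧ stretch g (2 * k)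
  ≡⟨ cong₂ _∧_ (⌊⌋-⇔ ((2 * k) % q′ ℕ.≟ j′) (k % q ℕ.≟ j) halve double) (stretch-even g k) ⟩
    ⌊ k % q ℕ.≟ j ⌋ ∧ g k
  ≡⟨ sym (stretch-even (select q j g) k) ⟩
    stretch (select q j g) (2 * k) ∎
  where
  open ≡-Reasoning
  halve : (2 * k) % q′ ≡ j′ → k % q ≡ j
  halve eq = ℕₚ.*-cancelʳ-≡ (k % q) j 2 (trans (sym (double-% q q′ q′≡ k)) (trans eq (sym j′≡)))
  double : k % q ≡ j → (2 * k) % q′ ≡ j′
  double eq = trans (double-% q q′ q′≡ k) (trans (cong (_* 2) eq) j′≡)
... | odd k = trans (cong (⌊ suc (2 * k) % q′ ℕ.≟ j′ ⌋ ∧_) (stretch-odd g k))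
                (trans (∧-zeroʳ _) (sym (stretch-odd (select q j g) k)))

select₂₀≐stretch : ∀ s t → (∀ k → s (2 * k) ≡ t k) → select 2 0 s ≐ stretch t
select₂₀≐stretch s t s₂ₖ≡tₖ n with parity n
... | even k = trans (cong₂ _∧_ (⌊⌋-true ((2 * k) % 2 ℕ.≟ 0) (trans (cong (_% 2) (ℕₚ.*-comm 2 k)) (m*n%n≡0 k 2))) (s₂ₖ≡tₖ k))
                     (sym (stretch-even t k))
... | odd  k = trans (cong (_∧ s (suc (2 * k))) (⌊⌋-false (suc (2 * k) % 2 ℕ.≟ 0)
                       (λ eq → 1≢0 (trans (sym ([m+kn]%n≡m%n 1 k 2)) (trans (cong (λ m → suc m % 2) (ℕₚ.*-comm k 2)) eq)))))
                     (sym (stretch-odd t k))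
  where
  1≢0 : 1 ≢ 0
  1≢0 ()

stretch-* : ∀ s t → stretch (s *PS t) ≐ stretch s *PS stretch t
stretch-* s t = begin
    stretch (s *PS t)
  ≈⟨ ≐-sym (frobenius (s *PS t)) ⟩
    (s *PS t) *PS (s *PS t)
  ≈⟨ solve 2 (λ s t → (s :* t) :* (s :* t) := (s :* s) :* (t :* t)) ≐-refl s t ⟩
    (s *PS s) *PS (t *PS t)
  ≈⟨ *PS-cong (frobenius s) (frobenius t) ⟩
    stretch s *PS stretch t ∎
  where
  open ≐-Reasoning
  open PS-Solver

supportedIn-1 : ∀ s → SupportedIn 1 0 s
supportedIn-1 s n _ = n%1≡0 n

stretch-supportedIn-2 : ∀ s → SupportedIn 2 0 (stretch s)
stretch-supportedIn-2 s = stretch-supportedIn 1 2 refl 0 s (supportedIn-1 s)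

stretch²-supportedIn : ∀ s → SupportedIn 4 0 (stretch (stretch s))
stretch²-supportedIn s = stretch-supportedIn 2 4 refl 0 (stretch s) (stretch-supportedIn-2 s)

stretch³ : PS → PS
stretch³ s = stretch (stretch (stretch s))

stretch³-supportedIn : ∀ s → SupportedIn 8 0 (stretch³ s)
stretch³-supportedIn s = stretch-supportedIn 4 8 refl 0 (stretch (stretch s)) (stretch²-supportedIn s)

stretch³-cong : ∀ {s t} → s ≐ t → stretch³ s ≐ stretch³ t
stretch³-cong s≐t = stretch-cong (stretch-cong (stretch-cong s≐t))

stretch³-* : ∀ s t → stretch³ (s *PS t) ≐ stretch³ s *PS stretch³ t
stretch³-* s t = ≐-trans (stretch-cong (stretch-cong (stretch-* s t)))
                (≐-trans (stretch-cong (stretch-* (stretch s) (stretch t)))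
                         (stretch-* (stretch (stretch s)) (stretch (stretch t))))

-- Monomials and inverses

monomial : ℕ → PS
monomial k n = ⌊ n ℕ.≟ k ⌋

monomial-*PS : ∀ k s n → (monomial k *PS s) n ≡ ⌊ k <? suc n ⌋ ∧ s (n ∸ k)
monomial-*PS k s n = trans (*PS-coeff (monomial k) s n) (xsumBelow-indicator (suc n) k (λ i → s (n ∸ i)))

monomial-*PS-+ : ∀ k s n → (monomial k *PS s) (k + n) ≡ s n
monomial-*PS-+ k s n = trans (monomial-*PS k s (k + n))
  (cong₂ _∧_ (⌊⌋-true (k <? suc (k + n)) (s≤s (ℕₚ.m≤m+n k n))) (cong s (ℕₚ.m+n∸m≡n k n)))

monomial-*PS-< : ∀ k s n → n < k → (monomial k *PS s) n ≡ false
monomial-*PS-< k s n n<k = trans (monomial-*PS k s n)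
  (cong (_∧ s (n ∸ k)) (⌊⌋-false (k <? suc n) (λ k≤n → ℕₚ.<-irrefl refl (ℕₚ.<-≤-trans n<k (ℕₚ.≤-pred k≤n)))))

monomial-cancel : ∀ k s t → monomial k *PS s ≐ monomial k *PS t → s ≐ t
monomial-cancel k s t eq n = trans (sym (monomial-*PS-+ k s n)) (trans (eq (k + n)) (monomial-*PS-+ k t n))

data Offset (k n : ℕ) : Set where
  below : n < k → Offset k n
  above : ∀ m → n ≡ k + m → Offset k n

offset : ∀ k n → Offset k n
offset k n with n <? k
... | yes n<k = below n<k
... | no  n≮k = above (n ∸ k) (sym (ℕₚ.m+[n∸m]≡n (ℕₚ.≮⇒≥ n≮k)))

monomial-*PS-monomial : ∀ k l → monomial k *PS monomial l ≐ monomial (k + l)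
monomial-*PS-monomial k l n with offset k n
... | below n<k = trans (monomial-*PS-< k (monomial l) n n<k)
      (sym (⌊⌋-false (n ℕ.≟ k + l) (λ n≡k+l → ℕₚ.<-irrefl refl (ℕₚ.<-≤-trans n<k (subst (k ≤_) (sym n≡k+l) (ℕₚ.m≤m+n k l))))))
... | above m refl = trans (monomial-*PS-+ k (monomial l) m)
      (⌊⌋-⇔ (m ℕ.≟ l) (k + m ℕ.≟ k + l) (cong (k ℕ.+_)) (ℕₚ.+-cancelˡ-≡ k m l))

stretch-monomial : ∀ k → stretch (monomial k) ≐ monomial (2 * k)
stretch-monomial k n = begin
    stretch (monomial k) n
  ≡⟨ sym (frobenius (monomial k) n) ⟩
    (monomial k *PS monomial k) n
  ≡⟨ monomial-*PS-monomial k k n ⟩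
    monomial (k + k) n
  ≡⟨ cong (λ e → monomial e n) (cong (k ℕ.+_) (sym (ℕₚ.+-identityʳ k))) ⟩
    monomial (2 * k) n ∎
  where open ≡-Reasoning

stretch³-monomial : ∀ k → stretch³ (monomial k) ≐ monomial (8 * k)
stretch³-monomial k = ≐-trans (stretch-cong (stretch-cong (stretch-monomial k)))
  (≐-trans (stretch-cong (stretch-monomial (2 * k)))
  (≐-trans (stretch-monomial (2 * (2 * k)))
  (λ n → cong (λ e → monomial e n) (trans (cong (2 *_) (sym (ℕₚ.*-assoc 2 2 k))) (sym (ℕₚ.*-assoc 2 4 k))))))

-- For u 0 = true, (u v) (n + 1) = 0 forces v (n + 1) = (tail u *PS v) n; inverseUpTo u n holds
-- the coefficients 0..n of v obtained this way, its later entries are junk.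
inverseUpTo : PS → ℕ → PS
inverseUpTo u zero    = monomial 0
inverseUpTo u (suc n) i = if ⌊ i ≤? n ⌋ then inverseUpTo u n i else (tail u *PS inverseUpTo u n) n

inverse : PS → PS
inverse u i = inverseUpTo u i i

inverseUpTo-stable : ∀ u n d i → i ≤ n → inverseUpTo u (n + d) i ≡ inverseUpTo u n i
inverseUpTo-stable u n zero    i i≤n = cong (λ m → inverseUpTo u m i) (ℕₚ.+-identityʳ n)
inverseUpTo-stable u n (suc d) i i≤n = begin
    inverseUpTo u (n + suc d) i
  ≡⟨ cong (λ m → inverseUpTo u m i) (ℕₚ.+-suc n d) ⟩
    (if ⌊ i ≤? n + d ⌋ then inverseUpTo u (n + d) i else _)
  ≡⟨ cong (if_then inverseUpTo u (n + d) i else _) (⌊⌋-true (i ≤? n + d) (ℕₚ.≤-trans i≤n (ℕₚ.m≤m+n n d))) ⟩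
    inverseUpTo u (n + d) i
  ≡⟨ inverseUpTo-stable u n d i i≤n ⟩
    inverseUpTo u n i ∎
  where open ≡-Reasoning

inverse≡inverseUpTo : ∀ u n i → i ≤ n → inverse u i ≡ inverseUpTo u n i
inverse≡inverseUpTo u n i i≤n = trans (sym (inverseUpTo-stable u i (n ∸ i) i ℕₚ.≤-refl))
                                      (cong (λ m → inverseUpTo u m i) (ℕₚ.m+[n∸m]≡n i≤n))

inverse-suc : ∀ u n → inverse u (suc n) ≡ (tail u *PS inverse u) n
inverse-suc u n = begin
    inverseUpTo u (suc n) (suc n)
  ≡⟨ cong (if_then inverseUpTo u n (suc n) else (tail u *PS inverseUpTo u n) n)
          (⌊⌋-false (suc n ≤? n) (ℕₚ.<-irrefl refl)) ⟩
    (tail u *PS inverseUpTo u n) n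
  ≡⟨ *PS-coeff (tail u) (inverseUpTo u n) n ⟩
    xsumBelow (suc n) (λ i → tail u i ∧ inverseUpTo u n (n ∸ i))
  ≡⟨ xsumBelow-cong (suc n) (λ i _ → cong (tail u i ∧_) (sym (inverse≡inverseUpTo u n (n ∸ i) (ℕₚ.m∸n≤m n i)))) ⟩
    xsumBelow (suc n) (λ i → tail u i ∧ inverse u (n ∸ i))
  ≡⟨ sym (*PS-coeff (tail u) (inverse u) n) ⟩
    (tail u *PS inverse u) n ∎
  where open ≡-Reasoning

*PS-inverse : ∀ u → u 0 ≡ true → u *PS inverse u ≐ 1ₛ
*PS-inverse u u₀ zero    = trans (*PS-coeff-0 u (inverse u)) (cong (_∧ true) u₀)
*PS-inverse u u₀ (suc n) = begin
    (u *PS inverse u) (suc n)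
  ≡⟨ tail-*PS u (inverse u) n ⟩
    (u 0 ∧ inverse u (suc n)) xor (tail u *PS inverse u) n
  ≡⟨ cong₂ (λ x y → (x ∧ y) xor (tail u *PS inverse u) n) u₀ (inverse-suc u n) ⟩
    (tail u *PS inverse u) n xor (tail u *PS inverse u) n
  ≡⟨ xor-same ((tail u *PS inverse u) n) ⟩
    false ∎
  where open ≡-Reasoning

-- Laurent series

%ℕ-unique : ∀ d .{{_ : NonZero d}} z ρ (t : ℤ) → ρ < d → z ≡ + ρ ℤ.+ t ℤ.* + d → z %ℕ d ≡ ρ
%ℕ-unique d z ρ t ρ<d z≡ = go (t ℤ.- q) r≡
  where
  open ℤ-Solver.+-*-Solver
  r = z %ℕ d
  q = z /ℕ d
  r≡ : + r ≡ + ρ ℤ.+ (t ℤ.- q) ℤ.* + d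
  r≡ = trans (solve 3 (λ r q d → r := (r :+ q :* d) :- q :* d) refl (+ r) q (+ d))
       (trans (cong (λ w → w ℤ.- q ℤ.* + d) (trans (sym (a≡a%ℕn+[a/ℕn]*n z d)) z≡))
       (solve 4 (λ ρ t q d → ρ :+ t :* d :- q :* d := ρ :+ (t :- q) :* d) refl (+ ρ) t q (+ d)))
  d≤ : ∀ a x → d ≤ a + (d + x * d)
  d≤ a x = ℕₚ.≤-trans (ℕₚ.m≤m+n d (x * d)) (ℕₚ.m≤n+m (d + x * d) a)
  go : ∀ e → + r ≡ + ρ ℤ.+ e ℤ.* + d → r ≡ ρ
  go (+ zero) eq = ℤₚ.+-injective (trans eq (trans (cong (λ w → + ρ ℤ.+ w) (ℤₚ.*-zeroˡ (+ d))) (ℤₚ.+-identityʳ (+ ρ))))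
  go (+ suc x) eq = ⊥-elim (ℕₚ.<-irrefl refl (ℕₚ.<-≤-trans (n%ℕd<d z d) (subst (d ≤_) (sym r≡ρ+) (d≤ ρ x))))
    where
    r≡ρ+ : r ≡ ρ + (d + x * d)
    r≡ρ+ = ℤₚ.+-injective (trans eq (trans (cong (λ w → + ρ ℤ.+ w) (sym (ℤₚ.pos-* (suc x) d))) (sym (ℤₚ.pos-+ ρ (d + x * d)))))
  go -[1+ x ] eq = ⊥-elim (ℕₚ.<-irrefl refl (ℕₚ.<-≤-trans ρ<d (subst (d ≤_) (sym ρ≡r+) (d≤ r x))))
    where
    ρ≡r+ : ρ ≡ r + (d + x * d)
    ρ≡r+ = ℤₚ.+-injective (trans (solve 3 (λ ρ e d → ρ := (ρ :+ (:- e) :* d) :+ e :* d) refl (+ ρ) (+ suc x) (+ d))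
            (trans (cong (ℤ._+ (+ suc x) ℤ.* + d) (sym eq))
            (trans (cong (λ w → + r ℤ.+ w) (sym (ℤₚ.pos-* (suc x) d))) (sym (ℤₚ.pos-+ r (d + x * d))))))

%ℕ-+-multiple : ∀ d .{{_ : NonZero d}} z (t : ℤ) → (z ℤ.+ t ℤ.* + d) %ℕ d ≡ z %ℕ d
%ℕ-+-multiple d z t = %ℕ-unique d (z ℤ.+ t ℤ.* + d) (z %ℕ d) (z /ℕ d ℤ.+ t) (n%ℕd<d z d)
  (trans (cong (ℤ._+ t ℤ.* + d) (a≡a%ℕn+[a/ℕn]*n z d))
         (solve 4 (λ r q t d → (r :+ q :* d) :+ t :* d := r :+ (q :+ t) :* d) refl (+ (z %ℕ d)) (z /ℕ d) t (+ d)))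
  where open ℤ-Solver.+-*-Solver

-- proj 8 j (laurent k g) is by definition laurent k (shiftedSelect k j g): the class of
-- an exponent m of g is taken for the Laurent exponent m - k.
shiftedSelect : ℕ → ℕ → PS → PS
shiftedSelect k j = restrictBy (λ m → ⌊ ((+ m) ℤ.- (+ k)) %ℕ 8 ℕ.≟ j ⌋)

shiftedSelect-periodic : ∀ k j → Periodic 8 (λ m → ⌊ ((+ m) ℤ.- (+ k)) %ℕ 8 ℕ.≟ j ⌋)
shiftedSelect-periodic k j i n i≤n n∸i≡0 =
  cong (λ r → ⌊ r ℕ.≟ j ⌋) (trans (cong (_%ℕ 8) n-k≡) (%ℕ-+-multiple 8 ((+ i) ℤ.- (+ k)) (+ ((n ∸ i) ℕ./ 8))))
  where
  open ℤ-Solver.+-*-Solver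
  d = n ∸ i
  d≡ : d ≡ (d ℕ./ 8) * 8
  d≡ = trans (m≡m%n+[m/n]*n d 8) (cong (_+ (d ℕ./ 8) * 8) n∸i≡0)
  n-k≡ : (+ n) ℤ.- (+ k) ≡ ((+ i) ℤ.- (+ k)) ℤ.+ (+ (d ℕ./ 8)) ℤ.* + 8
  n-k≡ = begin
      (+ n) ℤ.- (+ k)
    ≡⟨ cong (λ w → + w ℤ.- + k) (sym (ℕₚ.m+[n∸m]≡n i≤n)) ⟩
      + (i + d) ℤ.- + k
    ≡⟨ cong (λ w → + (i + w) ℤ.- + k) d≡ ⟩
      + (i + (d ℕ./ 8) * 8) ℤ.- + k
    ≡⟨ cong (ℤ._- + k) (trans (ℤₚ.pos-+ i _) (cong (λ w → + i ℤ.+ w) (ℤₚ.pos-* (d ℕ./ 8) 8))) ⟩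
      (+ i ℤ.+ + (d ℕ./ 8) ℤ.* + 8) ℤ.- + k
    ≡⟨ solve 4 (λ i k t e → (i :+ t :* e) :- k := (i :- k) :+ t :* e) refl (+ i) (+ k) (+ (d ℕ./ 8)) (+ 8) ⟩
      ((+ i) ℤ.- (+ k)) ℤ.+ (+ (d ℕ./ 8)) ℤ.* + 8 ∎
    where open ≡-Reasoning

shiftedSelect-cong : ∀ k j {s t} → s ≐ t → shiftedSelect k j s ≐ shiftedSelect k j t
shiftedSelect-cong k j = restrictBy-cong _

shiftedSelect-*PS-supported₀ : ∀ k j g h → SupportedIn 8 0 h →
                               shiftedSelect k j (g *PS h) ≐ shiftedSelect k j g *PS h
shiftedSelect-*PS-supported₀ k j g h = restrictBy-*PS 8 _ g h (shiftedSelect-periodic k j)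

[k+m]-k≡m : ∀ k m → (+ (k + m)) ℤ.- (+ k) ≡ + m
[k+m]-k≡m k m = trans (cong (ℤ._- + k) (ℤₚ.pos-+ k m)) (solve 2 (λ m k → (k :+ m) :- k := m) refl (+ m) (+ k))
  where open ℤ-Solver.+-*-Solver

shiftedSelect-monomial : ∀ k j s → shiftedSelect k j (monomial k *PS s) ≐ monomial k *PS select 8 j s
shiftedSelect-monomial k j s m with offset k m
... | below m<k = trans (cong (_ ∧_) (monomial-*PS-< k s m m<k))
                    (trans (∧-zeroʳ _) (sym (monomial-*PS-< k (select 8 j s) m m<k)))
... | above m′ refl = trans (cong₂ _∧_ (cong (λ w → ⌊ w %ℕ 8 ℕ.≟ j ⌋) ([k+m]-k≡m k m′)) (monomial-*PS-+ k s m′))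
                        (sym (monomial-*PS-+ k (select 8 j s) m′))

neg+k≡+m⇒m<k : ∀ j k m → -[1+ j ] ℤ.+ (+ k) ≡ + m → m < k
neg+k≡+m⇒m<k j k m eq = subst (m <_) (sym k≡m+1+j) (ℕₚ.m<m+n m (s≤s z≤n))
  where
  open ℤ-Solver.+-*-Solver
  k≡m+1+j : k ≡ m + suc j
  k≡m+1+j = ℤₚ.+-injective (begin
      + k
    ≡⟨ solve 2 (λ k j → k := (j :+ k) :- j) refl (+ k) -[1+ j ] ⟩
      (-[1+ j ] ℤ.+ + k) ℤ.- -[1+ j ]
    ≡⟨ cong (ℤ._- -[1+ j ]) eq ⟩
      + m ℤ.+ + suc j
    ≡⟨ sym (ℤₚ.pos-+ m (suc j)) ⟩
      + (m + suc j) ∎)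
    where open ≡-Reasoning

laurent≈Lι : ∀ k s t → s ≐ monomial k *PS t → laurent k s ≈L ι t
laurent≈Lι k s t s≐ (+ j) = begin
    s (j + k)
  ≡⟨ s≐ (j + k) ⟩
    (monomial k *PS t) (j + k)
  ≡⟨ cong (monomial k *PS t) (ℕₚ.+-comm j k) ⟩
    (monomial k *PS t) (k + j)
  ≡⟨ monomial-*PS-+ k t j ⟩
    t j
  ≡⟨ cong t (sym (ℕₚ.+-identityʳ j)) ⟩
    t (j + 0) ∎
  where open ≡-Reasoning
laurent≈Lι k s t s≐ -[1+ j ] with -[1+ j ] ℤ.+ + k in eq
... | + m       = trans (s≐ m) (monomial-*PS-< k t m (neg+k≡+m⇒m<k j k m eq))
... | -[1+ _ ]  = refl

coeff-laurent : ∀ k s n m → n ℤ.+ + k ≡ + m → coeff (laurent k s) n ≡ s m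
coeff-laurent k s n m eq with n ℤ.+ + k
coeff-laurent k s n m refl | .(+ m) = refl

laurent≈Lι⇒ : ∀ k s t → laurent k s ≈L ι t → s ≐ monomial k *PS t
laurent≈Lι⇒ k s t eq m with offset k m
... | below m<k = begin
    s m
  ≡⟨ sym (coeff-laurent k s -[1+ d ] m -[1+d]+k≡m) ⟩
    coeff (laurent k s) -[1+ d ]
  ≡⟨ eq -[1+ d ] ⟩
    false
  ≡⟨ sym (monomial-*PS-< k t m m<k) ⟩
    (monomial k *PS t) m ∎
  where
  open ≡-Reasoning
  open ℤ-Solver.+-*-Solver using (solve; _:=_; _:+_; :-_)
  d = k ∸ suc m
  k≡ : k ≡ m + suc d
  k≡ = trans (sym (ℕₚ.m+[n∸m]≡n m<k)) (sym (ℕₚ.+-suc m d))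
  -[1+d]+k≡m : -[1+ d ] ℤ.+ + k ≡ + m
  -[1+d]+k≡m = begin
      -[1+ d ] ℤ.+ + k
    ≡⟨ cong (λ w → -[1+ d ] ℤ.+ + w) k≡ ⟩
      -[1+ d ] ℤ.+ + (m + suc d)
    ≡⟨ cong (λ w → -[1+ d ] ℤ.+ w) (ℤₚ.pos-+ m (suc d)) ⟩
      -[1+ d ] ℤ.+ (+ m ℤ.+ + suc d)
    ≡⟨ solve 2 (λ m e → (:- e) :+ (m :+ e) := m) refl (+ m) (+ suc d) ⟩
      + m ∎
... | above m′ refl = begin
    s (k + m′)
  ≡⟨ cong s (ℕₚ.+-comm k m′) ⟩
    coeff (laurent k s) (+ m′)
  ≡⟨ eq (+ m′) ⟩
    t (m′ + 0)
  ≡⟨ cong t (ℕₚ.+-identityʳ m′) ⟩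
    t m′
  ≡⟨ sym (monomial-*PS-+ k t m′) ⟩
    (monomial k *PS t) (k + m′) ∎
  where open ≡-Reasoning

-- The classes of 1/a modulo 8

ser-ι^L2 : ∀ s → ser (ι s ^L 2) ≐ stretch s
ser-ι^L2 s = ≐-trans (*PS-congˡ {s} (λ n → trans (*PS-comm s 1ₛ n) (*PS-identityˡ s n))) (frobenius s)

ser-ι^L8 : ∀ s → ser (ι s ^L 8) ≐ stretch³ s
ser-ι^L8 s = begin
    ser (ι s ^L 8)
  ≈⟨ solve 1 (λ x → x :* (x :* (x :* (x :* (x :* (x :* (x :* (x :* con 1)))))))
                   := ((x :* x) :* (x :* x)) :* ((x :* x) :* (x :* x))) ≐-refl s ⟩
    ((s *PS s) *PS (s *PS s)) *PS ((s *PS s) *PS (s *PS s))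
  ≈⟨ *PS-cong (frobenius (s *PS s)) (frobenius (s *PS s)) ⟩
    stretch (s *PS s) *PS stretch (s *PS s)
  ≈⟨ frobenius (stretch (s *PS s)) ⟩
    stretch (stretch (s *PS s))
  ≈⟨ stretch-cong (stretch-cong (frobenius s)) ⟩
    stretch³ s ∎
  where
  open ≐-Reasoning
  open PS-Solver

module InverseClasses (a b c : PS)
  (even-a : select 2 0 a ≐ stretch (stretch b))
  (odd-a : SupportedIn 4 1 (select 2 1 a))
  (even-ab : select 2 0 (a *PS b) ≐ stretch (a *PS c)) where

  open ≐-Reasoning
  open PS-Solver using (solve; _:*_; _:=_)

  aₒ a³ a⁷ : PS
  aₒ = select 2 1 a
  a³ = a *PS stretch a
  a⁷ = a *PS stretch a³

  select-even-a*stretch : ∀ h → select 2 0 (a *PS stretch h) ≐ stretch (stretch b *PS h)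
  select-even-a*stretch h = begin
      select 2 0 (a *PS stretch h)
    ≈⟨ select-*PS-supported₀ 2 0 a (stretch h) (stretch-supportedIn-2 h) ⟩
      select 2 0 a *PS stretch h
    ≈⟨ *PS-congʳ {stretch h} even-a ⟩
      stretch (stretch b) *PS stretch h
    ≈⟨ ≐-sym (stretch-* (stretch b) h) ⟩
      stretch (stretch b *PS h) ∎

  select-odd-a*stretch : ∀ h → select 2 1 (a *PS stretch h) ≐ aₒ *PS stretch h
  select-odd-a*stretch h = select-*PS-supported₀ 2 1 a (stretch h) (stretch-supportedIn-2 h)

  select-a³*stretch-b : ∀ j → select 2 j (stretch b *PS a³) ≐ select 2 j a³ *PS stretch b
  select-a³*stretch-b j = begin
      select 2 j (stretch b *PS a³)
    ≈⟨ select-cong 2 j (*PS-comm (stretch b) a³) ⟩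
      select 2 j (a³ *PS stretch b)
    ≈⟨ select-*PS-supported₀ 2 j a³ (stretch b) (stretch-supportedIn-2 b) ⟩
      select 2 j a³ *PS stretch b ∎

  select₄₀-a⁷ : select 4 0 a⁷ ≐ stretch (stretch ((stretch b *PS a) *PS b))
  select₄₀-a⁷ = begin
      select 4 0 a⁷
    ≈⟨ ≐-sym (select-select 2 4 (divides 2 refl) 0 0 refl a⁷) ⟩
      select 4 0 (select 2 0 a⁷)
    ≈⟨ select-cong 4 0 (select-even-a*stretch a³) ⟩
      select 4 0 (stretch (stretch b *PS a³))
    ≈⟨ select-stretch 2 4 refl 0 0 refl (stretch b *PS a³) ⟩
      stretch (select 2 0 (stretch b *PS a³))
    ≈⟨ stretch-cong (select-a³*stretch-b 0) ⟩
      stretch (select 2 0 a³ *PS stretch b)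
    ≈⟨ stretch-cong (*PS-congʳ {stretch b} (select-even-a*stretch a)) ⟩
      stretch (stretch (stretch b *PS a) *PS stretch b)
    ≈⟨ stretch-cong (≐-sym (stretch-* (stretch b *PS a) b)) ⟩
      stretch (stretch ((stretch b *PS a) *PS b)) ∎

  select₈₀-a⁷ : select 8 0 a⁷ ≐ stretch³ ((a *PS c) *PS b)
  select₈₀-a⁷ = begin
      select 8 0 a⁷
    ≈⟨ ≐-sym (select-select 4 8 (divides 2 refl) 0 0 refl a⁷) ⟩
      select 8 0 (select 4 0 a⁷)
    ≈⟨ select-cong 8 0 select₄₀-a⁷ ⟩
      select 8 0 (stretch (stretch ((stretch b *PS a) *PS b)))
    ≈⟨ select-stretch 4 8 refl 0 0 refl _ ⟩
      stretch (select 4 0 (stretch ((stretch b *PS a) *PS b)))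
    ≈⟨ stretch-cong (select-stretch 2 4 refl 0 0 refl _) ⟩
      stretch (stretch (select 2 0 ((stretch b *PS a) *PS b)))
    ≈⟨ stretch-cong (stretch-cong (select-cong 2 0
         (solve 3 (λ a b b² → (b² :* a) :* b := (a :* b) :* b²) ≐-refl a b (stretch b)))) ⟩
      stretch (stretch (select 2 0 ((a *PS b) *PS stretch b)))
    ≈⟨ stretch-cong (stretch-cong (select-*PS-supported₀ 2 0 (a *PS b) (stretch b) (stretch-supportedIn-2 b))) ⟩
      stretch (stretch (select 2 0 (a *PS b) *PS stretch b))
    ≈⟨ stretch-cong (stretch-cong (*PS-congʳ {stretch b} even-ab)) ⟩
      stretch (stretch (stretch (a *PS c) *PS stretch b))
    ≈⟨ stretch-cong (stretch-cong (≐-sym (stretch-* (a *PS c) b))) ⟩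
      stretch³ ((a *PS c) *PS b) ∎

  select₄₂-a⁷ : select 4 2 a⁷ ≐ stretch (aₒ *PS stretch (a *PS b))
  select₄₂-a⁷ = begin
      select 4 2 a⁷
    ≈⟨ ≐-sym (select-select 2 4 (divides 2 refl) 2 0 refl a⁷) ⟩
      select 4 2 (select 2 0 a⁷)
    ≈⟨ select-cong 4 2 (select-even-a*stretch a³) ⟩
      select 4 2 (stretch (stretch b *PS a³))
    ≈⟨ select-stretch 2 4 refl 1 2 refl (stretch b *PS a³) ⟩
      stretch (select 2 1 (stretch b *PS a³))
    ≈⟨ stretch-cong (select-a³*stretch-b 1) ⟩
      stretch (select 2 1 a³ *PS stretch b)
    ≈⟨ stretch-cong (*PS-congʳ {stretch b} (select-odd-a*stretch a)) ⟩
      stretch ((aₒ *PS stretch a) *PS stretch b)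
    ≈⟨ stretch-cong (*PS-assoc aₒ (stretch a) (stretch b)) ⟩
      stretch (aₒ *PS (stretch a *PS stretch b))
    ≈⟨ stretch-cong (*PS-congˡ {aₒ} (≐-sym (stretch-* a b))) ⟩
      stretch (aₒ *PS stretch (a *PS b)) ∎

  -- The odd part of ab contributes only to exponents 1 + 2 ≡ 3 (mod 4).
  select₄₁-aₒ*stretch-ab : select 4 1 (aₒ *PS stretch (a *PS b)) ≐ aₒ *PS stretch (stretch (a *PS c))
  select₄₁-aₒ*stretch-ab = begin
      select 4 1 (aₒ *PS stretch (a *PS b))
    ≈⟨ select-cong 4 1 (*PS-congˡ {aₒ} (stretch-cong (evenPart+oddPart (a *PS b)))) ⟩
      select 4 1 (aₒ *PS stretch (select 2 0 (a *PS b) +PS abₒ))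
    ≈⟨ select-cong 4 1 (*PS-congˡ {aₒ} (≐-trans (stretch-+ (select 2 0 (a *PS b)) abₒ)
                                                  (λ n → cong (_xor stretch abₒ n) (stretch-cong even-ab n)))) ⟩
      select 4 1 (aₒ *PS (stretch (stretch (a *PS c)) +PS stretch abₒ))
    ≈⟨ select-cong 4 1 (solve 3 (λ x y z → x :* (y :+ z) := x :* y :+ x :* z) ≐-refl aₒ (stretch (stretch (a *PS c))) (stretch abₒ)) ⟩
      select 4 1 ((aₒ *PS stretch (stretch (a *PS c))) +PS (aₒ *PS stretch abₒ))
    ≈⟨ select-+ 4 1 (aₒ *PS stretch (stretch (a *PS c))) (aₒ *PS stretch abₒ) ⟩
      select 4 1 (aₒ *PS stretch (stretch (a *PS c))) +PS select 4 1 (aₒ *PS stretch abₒ)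
    ≈⟨ (λ n → cong₂ _xor_ (select-*PS-supported₀ 4 1 aₒ _ (stretch²-supportedIn (a *PS c)) n)
               (select-*PS-outside 4 1 2 1 aₒ (stretch abₒ) odd-a
                  (stretch-supportedIn 2 4 refl 1 abₒ (select-supportedIn 2 1 (a *PS b))) (λ ()) n)) ⟩
      (select 4 1 aₒ *PS stretch (stretch (a *PS c))) +PS 0ₛ
    ≈⟨ (λ n → xor-identityʳ _) ⟩
      select 4 1 aₒ *PS stretch (stretch (a *PS c))
    ≈⟨ *PS-congʳ {stretch (stretch (a *PS c))} (select-supported 4 1 aₒ odd-a) ⟩
      aₒ *PS stretch (stretch (a *PS c)) ∎
    where
    open PS-Solver using (_:+_)
    abₒ = select 2 1 (a *PS b)

  select₈₂-a⁷ : select 8 2 a⁷ ≐ stretch (aₒ *PS stretch (stretch (a *PS c)))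
  select₈₂-a⁷ = begin
      select 8 2 a⁷
    ≈⟨ ≐-sym (select-select 4 8 (divides 2 refl) 2 2 refl a⁷) ⟩
      select 8 2 (select 4 2 a⁷)
    ≈⟨ select-cong 8 2 select₄₂-a⁷ ⟩
      select 8 2 (stretch (aₒ *PS stretch (a *PS b)))
    ≈⟨ select-stretch 4 8 refl 1 2 refl (aₒ *PS stretch (a *PS b)) ⟩
      stretch (select 4 1 (aₒ *PS stretch (a *PS b)))
    ≈⟨ stretch-cong select₄₁-aₒ*stretch-ab ⟩
      stretch (aₒ *PS stretch (stretch (a *PS c))) ∎

  a*a⁷ : a *PS a⁷ ≐ stretch³ a
  a*a⁷ = begin
      a *PS (a *PS stretch a³)
    ≈⟨ ≐-sym (*PS-assoc a a (stretch a³)) ⟩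
      (a *PS a) *PS stretch a³
    ≈⟨ *PS-congʳ {stretch a³} (frobenius a) ⟩
      stretch a *PS stretch a³
    ≈⟨ ≐-sym (stretch-* a a³) ⟩
      stretch (a *PS (a *PS stretch a))
    ≈⟨ stretch-cong (≐-sym (*PS-assoc a a (stretch a))) ⟩
      stretch ((a *PS a) *PS stretch a)
    ≈⟨ stretch-cong (*PS-congʳ {stretch a} (frobenius a)) ⟩
      stretch (stretch a *PS stretch a)
    ≈⟨ stretch-cong (frobenius (stretch a)) ⟩
      stretch³ a ∎

  -- If a g = x^k then g = x^k · a⁷ / a⁸ with a⁸ = stretch³ a supported on multiples of 8,
  -- so selecting a class of g amounts to selecting that class of a⁷.
  shiftedSelect-inverse : ∀ k g j R → a *PS g ≐ monomial k → select 8 j a⁷ ≐ stretch³ a *PS R →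
                          shiftedSelect k j g ≐ monomial k *PS R
  shiftedSelect-inverse k g j R ag≐xᵏ select-a⁷ = monomial-cancel (8 * k) gⱼ (monomial k *PS R) (begin
      monomial (8 * k) *PS gⱼ
    ≈⟨ *PS-comm (monomial (8 * k)) gⱼ ⟩
      gⱼ *PS monomial (8 * k)
    ≈⟨ *PS-congˡ {gⱼ} (≐-trans (≐-sym (stretch³-monomial k)) (stretch³-cong (≐-sym ag≐xᵏ))) ⟩
      gⱼ *PS stretch³ (a *PS g)
    ≈⟨ *PS-congˡ {gⱼ} (stretch³-* a g) ⟩
      gⱼ *PS (stretch³ a *PS stretch³ g)
    ≈⟨ ≐-sym (*PS-assoc gⱼ (stretch³ a) (stretch³ g)) ⟩
      (gⱼ *PS stretch³ a) *PS stretch³ g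
    ≈⟨ *PS-congʳ {stretch³ g} (≐-sym (shiftedSelect-*PS-supported₀ k j g (stretch³ a) (stretch³-supportedIn a))) ⟩
      shiftedSelect k j (g *PS stretch³ a) *PS stretch³ g
    ≈⟨ *PS-congʳ {stretch³ g} (shiftedSelect-cong k j ga⁸≐xᵏa⁷) ⟩
      shiftedSelect k j (monomial k *PS a⁷) *PS stretch³ g
    ≈⟨ *PS-congʳ {stretch³ g} (shiftedSelect-monomial k j a⁷) ⟩
      (monomial k *PS select 8 j a⁷) *PS stretch³ g
    ≈⟨ *PS-congʳ {stretch³ g} (*PS-congˡ {monomial k} select-a⁷) ⟩
      (monomial k *PS (stretch³ a *PS R)) *PS stretch³ g
    ≈⟨ solve 4 (λ x a r g → (x :* (a :* r)) :* g := (x :* r) :* (a :* g)) ≐-refl (monomial k) (stretch³ a) R (stretch³ g) ⟩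
      (monomial k *PS R) *PS (stretch³ a *PS stretch³ g)
    ≈⟨ *PS-congˡ {monomial k *PS R} (≐-sym (stretch³-* a g)) ⟩
      (monomial k *PS R) *PS stretch³ (a *PS g)
    ≈⟨ *PS-congˡ {monomial k *PS R} (≐-trans (stretch³-cong ag≐xᵏ) (stretch³-monomial k)) ⟩
      (monomial k *PS R) *PS monomial (8 * k)
    ≈⟨ *PS-comm (monomial k *PS R) (monomial (8 * k)) ⟩
      monomial (8 * k) *PS (monomial k *PS R) ∎)
    where
    gⱼ = shiftedSelect k j g
    ga⁸≐xᵏa⁷ : g *PS stretch³ a ≐ monomial k *PS a⁷
    ga⁸≐xᵏa⁷ = begin
        g *PS stretch³ a
      ≈⟨ *PS-congˡ {g} (≐-sym a*a⁷) ⟩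
        g *PS (a *PS a⁷)
      ≈⟨ solve 3 (λ g a x → g :* (a :* x) := (a :* g) :* x) ≐-refl g a a⁷ ⟩
        (a *PS g) *PS a⁷
      ≈⟨ *PS-congʳ {a⁷} ag≐xᵏ ⟩
        monomial k *PS a⁷ ∎

  b⁸c⁸ [a²+b⁸]c⁸ : Laurent
  b⁸c⁸ = (ι b ^L 8) *L (ι c ^L 8)
  [a²+b⁸]c⁸ = ((ι a ^L 2) +L (ι b ^L 8)) *L (ι c ^L 8)

  select₈₀-a⁷≐a⁸b⁸c⁸ : select 8 0 a⁷ ≐ stretch³ a *PS ser b⁸c⁸
  select₈₀-a⁷≐a⁸b⁸c⁸ = begin
      select 8 0 a⁷
    ≈⟨ select₈₀-a⁷ ⟩
      stretch³ ((a *PS c) *PS b)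
    ≈⟨ stretch³-cong (solve 3 (λ a b c → (a :* c) :* b := a :* (b :* c)) ≐-refl a b c) ⟩
      stretch³ (a *PS (b *PS c))
    ≈⟨ stretch³-* a (b *PS c) ⟩
      stretch³ a *PS stretch³ (b *PS c)
    ≈⟨ *PS-congˡ {stretch³ a} (stretch³-* b c) ⟩
      stretch³ a *PS (stretch³ b *PS stretch³ c)
    ≈⟨ *PS-congˡ {stretch³ a} (≐-sym (*PS-cong (ser-ι^L8 b) (ser-ι^L8 c))) ⟩
      stretch³ a *PS ser b⁸c⁸ ∎

  -- a = b(x⁴) + aₒ, and squaring is additive in characteristic 2.
  a²+b⁸≐aₒ² : stretch a +PS stretch³ b ≐ stretch aₒ
  a²+b⁸≐aₒ² = begin
      stretch a +PS stretch³ b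
    ≈⟨ (λ n → cong (_xor stretch³ b n) (stretch-cong (evenPart+oddPart a) n)) ⟩
      stretch (select 2 0 a +PS aₒ) +PS stretch³ b
    ≈⟨ (λ n → cong (_xor stretch³ b n) (trans (stretch-+ (select 2 0 a) aₒ n)
                                               (cong (_xor stretch aₒ n) (stretch-cong even-a n)))) ⟩
      (stretch³ b +PS stretch aₒ) +PS stretch³ b
    ≈⟨ (λ n → cancel (stretch³ b n) (stretch aₒ n)) ⟩
      stretch aₒ ∎
    where
    cancel : ∀ y x → (y xor x) xor y ≡ x
    cancel y x = trans (cong (_xor y) (xor-comm y x)) (trans (xor-assoc x y y) (trans (cong (x xor_) (xor-same y)) (xor-identityʳ x)))

  select₈₂-a⁷≐a⁸[a²+b⁸]c⁸ : select 8 2 a⁷ ≐ stretch³ a *PS ser [a²+b⁸]c⁸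
  select₈₂-a⁷≐a⁸[a²+b⁸]c⁸ = begin
      select 8 2 a⁷
    ≈⟨ select₈₂-a⁷ ⟩
      stretch (aₒ *PS stretch (stretch (a *PS c)))
    ≈⟨ stretch-* aₒ (stretch (stretch (a *PS c))) ⟩
      stretch aₒ *PS stretch³ (a *PS c)
    ≈⟨ *PS-congˡ {stretch aₒ} (stretch³-* a c) ⟩
      stretch aₒ *PS (stretch³ a *PS stretch³ c)
    ≈⟨ solve 3 (λ x y z → x :* (y :* z) := y :* (x :* z)) ≐-refl (stretch aₒ) (stretch³ a) (stretch³ c) ⟩
      stretch³ a *PS (stretch aₒ *PS stretch³ c)
    ≈⟨ *PS-congˡ {stretch³ a} (*PS-congʳ {stretch³ c} (≐-sym a²+b⁸≐aₒ²)) ⟩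
      stretch³ a *PS ((stretch a +PS stretch³ b) *PS stretch³ c)
    ≈⟨ *PS-congˡ {stretch³ a} (≐-sym (*PS-cong (λ n → cong₂ _xor_ (ser-ι^L2 a n) (ser-ι^L8 b n)) (ser-ι^L8 c))) ⟩
      stretch³ a *PS ser [a²+b⁸]c⁸ ∎

  proj-inverse : ∀ f → ι a *L f ≈L oneL → (proj 8 0 f ≈L b⁸c⁸) × (proj 8 2 f ≈L [a²+b⁸]c⁸)
  proj-inverse (laurent k g) af≈1 =
      laurent≈Lι k _ (ser b⁸c⁸) (shiftedSelect-inverse k g 0 (ser b⁸c⁸) ag≐xᵏ select₈₀-a⁷≐a⁸b⁸c⁸)
    , laurent≈Lι k _ (ser [a²+b⁸]c⁸) (shiftedSelect-inverse k g 2 (ser [a²+b⁸]c⁸) ag≐xᵏ select₈₂-a⁷≐a⁸[a²+b⁸]c⁸)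
    where
    ag≐xᵏ : a *PS g ≐ monomial k
    ag≐xᵏ = ≐-trans (laurent≈Lι⇒ k (a *PS g) 1ₛ af≈1) (λ n → trans (*PS-comm (monomial k) 1ₛ n) (*PS-identityˡ (monomial k) n))

-- Sums over symmetric ranges of integers

xsumℤ : ℕ → (ℤ → Bool) → Bool
xsumℤ zero    f = f (+ 0)
xsumℤ (suc M) f = f -[1+ M ] xor (xsumℤ M f xor f (+ suc M))

xsumBelow-xsumℤ : ∀ M f → xsumBelow (suc (M + M)) (λ j → f (+ j ℤ.- + M)) ≡ xsumℤ M f
xsumBelow-xsumℤ zero    f = xor-identityʳ _
xsumBelow-xsumℤ (suc M) f = begin
    xsumBelow (suc (suc M + suc M)) (λ j → f (+ j ℤ.- + suc M))
  ≡⟨ cong (λ n → xsumBelow (suc n) (λ j → f (+ j ℤ.- + suc M))) (cong suc (ℕₚ.+-suc M M)) ⟩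
    f (+ 0 ℤ.- + suc M) xor xsumBelow (suc (suc (M + M))) (λ j → f (+ suc j ℤ.- + suc M))
  ≡⟨ cong (f -[1+ M ] xor_) (xsumBelow-suc (suc (M + M)) (λ j → f (+ suc j ℤ.- + suc M))) ⟩
    f -[1+ M ] xor (xsumBelow (suc (M + M)) (λ j → f (+ suc j ℤ.- + suc M)) xor f (+ suc (suc (M + M)) ℤ.- + suc M))
  ≡⟨ cong₂ (λ x y → f -[1+ M ] xor (x xor f y))
       (xsumBelow-cong (suc (M + M)) (λ j _ → cong f (shift-down j))) top ⟩
    f -[1+ M ] xor (xsumBelow (suc (M + M)) (λ j → f (+ j ℤ.- + M)) xor f (+ suc M))
  ≡⟨ cong (λ x → f -[1+ M ] xor (x xor f (+ suc M))) (xsumBelow-xsumℤ M f) ⟩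
    xsumℤ (suc M) f ∎
  where
  open ≡-Reasoning
  open ℤ-Solver.+-*-Solver
  shift-down : ∀ j → + suc j ℤ.- + suc M ≡ + j ℤ.- + M
  shift-down j = trans (cong₂ ℤ._-_ (ℤₚ.pos-+ 1 j) (ℤₚ.pos-+ 1 M))
                       (solve 2 (λ j M → (con (+ 1) :+ j) :- (con (+ 1) :+ M) := j :- M) refl (+ j) (+ M))
  top : + suc (suc (M + M)) ℤ.- + suc M ≡ + suc M
  top = trans (cong (ℤ._- + suc M) (trans (cong +_ (cong suc (sym (ℕₚ.+-suc M M)))) (ℤₚ.pos-+ (suc M) (suc M))))
              (solve 1 (λ x → (x :+ x) :- x := x) refl (+ suc M))

xsum-intRange : ∀ M f → xsum (map f (intRange M)) ≡ xsumℤ M f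
xsum-intRange M f = begin
    xsum (map f (map (λ j → + j ℤ.- + M) (upTo (suc (M + M)))))
  ≡⟨ cong xsum (sym (map-∘ {g = f} {f = λ j → + j ℤ.- + M} (upTo (suc (M + M))))) ⟩
    xsum (map (λ j → f (+ j ℤ.- + M)) (upTo (suc (M + M))))
  ≡⟨ xsum-upTo (suc (M + M)) (λ j → f (+ j ℤ.- + M)) ⟩
    xsumBelow (suc (M + M)) (λ j → f (+ j ℤ.- + M))
  ≡⟨ xsumBelow-xsumℤ M f ⟩
    xsumℤ M f ∎
  where open ≡-Reasoning

xsumℤ-cong : ∀ M {f g} → (∀ p → ∣ p ∣ ≤ M → f p ≡ g p) → xsumℤ M f ≡ xsumℤ M g
xsumℤ-cong zero    eq = eq (+ 0) z≤n
xsumℤ-cong (suc M) eq = cong₂ _xor_ (eq -[1+ M ] ℕₚ.≤-refl)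
  (cong₂ _xor_ (xsumℤ-cong M (λ p ∣p∣≤M → eq p (ℕₚ.m≤n⇒m≤1+n ∣p∣≤M))) (eq (+ suc M) ℕₚ.≤-refl))

xsumℤ-false : ∀ M {f} → (∀ p → ∣ p ∣ ≤ M → f p ≡ false) → xsumℤ M f ≡ false
xsumℤ-false zero    eq = eq (+ 0) z≤n
xsumℤ-false (suc M) eq = cong₂ _xor_ (eq -[1+ M ] ℕₚ.≤-refl)
  (cong₂ _xor_ (xsumℤ-false M (λ p ∣p∣≤M → eq p (ℕₚ.m≤n⇒m≤1+n ∣p∣≤M))) (eq (+ suc M) ℕₚ.≤-refl))

xsumℤ-extend : ∀ M N f → M ≤ N → (∀ p → M < ∣ p ∣ → f p ≡ false) → xsumℤ N f ≡ xsumℤ M f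
xsumℤ-extend M N f M≤N outside = trans (cong (λ L → xsumℤ L f) (sym (ℕₚ.m∸n+n≡m M≤N))) (go (N ∸ M))
  where
  go : ∀ d → xsumℤ (d + M) f ≡ xsumℤ M f
  go zero    = refl
  go (suc d) = trans (cong₂ _xor_ (outside -[1+ d + M ] (s≤s (ℕₚ.m≤n+m M d)))
                       (cong₂ _xor_ (go d) (outside (+ suc (d + M)) (s≤s (ℕₚ.m≤n+m M d)))))
                     (xor-identityʳ _)

xsumℤ-xor : ∀ M f g → xsumℤ M (λ p → f p xor g p) ≡ xsumℤ M f xor xsumℤ M g
xsumℤ-xor zero    f g = refl
xsumℤ-xor (suc M) f g = begin
    (f -[1+ M ] xor g -[1+ M ]) xor (xsumℤ M (λ p → f p xor g p) xor (f (+ suc M) xor g (+ suc M)))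
  ≡⟨ cong (λ z → (f -[1+ M ] xor g -[1+ M ]) xor (z xor (f (+ suc M) xor g (+ suc M)))) (xsumℤ-xor M f g) ⟩
    (f -[1+ M ] xor g -[1+ M ]) xor ((xsumℤ M f xor xsumℤ M g) xor (f (+ suc M) xor g (+ suc M)))
  ≡⟨ cong ((f -[1+ M ] xor g -[1+ M ]) xor_) (interchange (xsumℤ M f) (xsumℤ M g) _ _) ⟩
    (f -[1+ M ] xor g -[1+ M ]) xor ((xsumℤ M f xor f (+ suc M)) xor (xsumℤ M g xor g (+ suc M)))
  ≡⟨ interchange (f -[1+ M ]) (g -[1+ M ]) _ _ ⟩
    xsumℤ (suc M) f xor xsumℤ (suc M) g ∎
  where open ≡-Reasoning

∧-distribˡ-xsumℤ : ∀ M b f → b ∧ xsumℤ M f ≡ xsumℤ M (λ p → b ∧ f p)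
∧-distribˡ-xsumℤ zero    b f = refl
∧-distribˡ-xsumℤ (suc M) b f = trans (∧-distribˡ-xor b (f -[1+ M ]) _)
  (cong ((b ∧ f -[1+ M ]) xor_) (trans (∧-distribˡ-xor b (xsumℤ M f) _) (cong (_xor (b ∧ f (+ suc M))) (∧-distribˡ-xsumℤ M b f))))

∧-distribʳ-xsumℤ : ∀ M f b → xsumℤ M f ∧ b ≡ xsumℤ M (λ p → f p ∧ b)
∧-distribʳ-xsumℤ M f b = trans (∧-comm (xsumℤ M f) b)
  (trans (∧-distribˡ-xsumℤ M b f) (xsumℤ-cong M (λ p _ → ∧-comm b (f p))))

xsumℤ-xsumBelow : ∀ M n (f : ℤ → ℕ → Bool) →
                  xsumℤ M (λ p → xsumBelow n (f p)) ≡ xsumBelow n (λ k → xsumℤ M (λ p → f p k))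
xsumℤ-xsumBelow zero    n f = refl
xsumℤ-xsumBelow (suc M) n f = begin
    xsumBelow n (f -[1+ M ]) xor (xsumℤ M (λ p → xsumBelow n (f p)) xor xsumBelow n (f (+ suc M)))
  ≡⟨ cong (λ z → xsumBelow n (f -[1+ M ]) xor (z xor xsumBelow n (f (+ suc M)))) (xsumℤ-xsumBelow M n f) ⟩
    xsumBelow n (f -[1+ M ]) xor (xsumBelow n (λ k → xsumℤ M (λ p → f p k)) xor xsumBelow n (f (+ suc M)))
  ≡⟨ cong (xsumBelow n (f -[1+ M ]) xor_) (sym (xsumBelow-xor n _ (f (+ suc M)))) ⟩
    xsumBelow n (f -[1+ M ]) xor xsumBelow n (λ k → xsumℤ M (λ p → f p k) xor f (+ suc M) k)
  ≡⟨ sym (xsumBelow-xor n (f -[1+ M ]) _) ⟩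
    xsumBelow n (λ k → xsumℤ (suc M) (λ p → f p k)) ∎
  where open ≡-Reasoning

xsumℤ-swap : ∀ M N (f : ℤ → ℤ → Bool) → xsumℤ M (λ p → xsumℤ N (f p)) ≡ xsumℤ N (λ q → xsumℤ M (λ p → f p q))
xsumℤ-swap zero    N f = refl
xsumℤ-swap (suc M) N f = begin
    xsumℤ N (f -[1+ M ]) xor (xsumℤ M (λ p → xsumℤ N (f p)) xor xsumℤ N (f (+ suc M)))
  ≡⟨ cong (λ z → xsumℤ N (f -[1+ M ]) xor (z xor xsumℤ N (f (+ suc M)))) (xsumℤ-swap M N f) ⟩
    xsumℤ N (f -[1+ M ]) xor (xsumℤ N (λ q → xsumℤ M (λ p → f p q)) xor xsumℤ N (f (+ suc M)))
  ≡⟨ cong (xsumℤ N (f -[1+ M ]) xor_) (sym (xsumℤ-xor N _ (f (+ suc M)))) ⟩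
    xsumℤ N (f -[1+ M ]) xor xsumℤ N (λ q → xsumℤ M (λ p → f p q) xor f (+ suc M) q)
  ≡⟨ sym (xsumℤ-xor N (f -[1+ M ]) _) ⟩
    xsumℤ N (λ q → xsumℤ (suc M) (λ p → f p q)) ∎
  where open ≡-Reasoning

xsumℤ-≟ : ∀ M w → ∣ w ∣ ≤ M → xsumℤ M (λ p → ⌊ p ℤ.≟ w ⌋) ≡ true
xsumℤ-≟ zero    (+ zero) _ = refl
xsumℤ-≟ (suc M) w ∣w∣≤ with ∣ w ∣ ℕ.≟ suc M
... | no ∣w∣≢ = begin
    ⌊ -[1+ M ] ℤ.≟ w ⌋ xor (xsumℤ M (λ p → ⌊ p ℤ.≟ w ⌋) xor ⌊ + suc M ℤ.≟ w ⌋)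
  ≡⟨ cong₂ (λ x y → x xor (xsumℤ M (λ p → ⌊ p ℤ.≟ w ⌋) xor y))
           (⌊⌋-false (-[1+ M ] ℤ.≟ w) (λ eq → ∣w∣≢ (cong ∣_∣ (sym eq))))
           (⌊⌋-false (+ suc M ℤ.≟ w) (λ eq → ∣w∣≢ (cong ∣_∣ (sym eq)))) ⟩
    xsumℤ M (λ p → ⌊ p ℤ.≟ w ⌋) xor false
  ≡⟨ xor-identityʳ _ ⟩
    xsumℤ M (λ p → ⌊ p ℤ.≟ w ⌋)
  ≡⟨ xsumℤ-≟ M w (ℕₚ.≤-pred (ℕₚ.≤∧≢⇒< ∣w∣≤ ∣w∣≢)) ⟩
    true ∎
  where open ≡-Reasoning
... | yes ∣w∣≡ = endpoint w ∣w∣≡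
  where
  interior : ∀ w → ∣ w ∣ ≡ suc M → xsumℤ M (λ p → ⌊ p ℤ.≟ w ⌋) ≡ false
  interior w ∣w∣≡ = xsumℤ-false M (λ p ∣p∣≤M → ⌊⌋-false (p ℤ.≟ w)
    (λ { refl → ℕₚ.<-irrefl refl (subst (_≤ M) ∣w∣≡ ∣p∣≤M) }))
  endpoint : ∀ w → ∣ w ∣ ≡ suc M → xsumℤ (suc M) (λ p → ⌊ p ℤ.≟ w ⌋) ≡ true
  endpoint (+ .(suc M)) refl =
    cong₂ (λ x y → false xor (x xor y)) (interior (+ suc M) refl) (⌊⌋-true (+ suc M ℤ.≟ + suc M) refl)
  endpoint -[1+ .M ] refl =
    trans (cong₂ (λ x y → ⌊ -[1+ M ] ℤ.≟ -[1+ M ] ⌋ xor (x xor y)) (interior -[1+ M ] refl) (⌊⌋-false (+ suc M ℤ.≟ -[1+ M ]) (λ ())))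
          (trans (xor-identityʳ _) (⌊⌋-true (-[1+ M ] ℤ.≟ -[1+ M ]) refl))

record XorSums (A : Set) : Set₁ where
  field
    _≟_             : DecidableEquality A
    InRange         : ℕ → A → Set
    sum             : ℕ → (A → Bool) → Bool
    sum-cong        : ∀ N {f g} → (∀ x → f x ≡ g x) → sum N f ≡ sum N g
    ∧-distribˡ-sum  : ∀ N b f → b ∧ sum N f ≡ sum N (λ x → b ∧ f x)
    sum-swap        : ∀ M N (h : A → A → Bool) → sum M (λ x → sum N (h x)) ≡ sum N (λ y → sum M (λ x → h x y))
    sum-≟           : ∀ N a → InRange N a → sum N (λ x → ⌊ x ≟ a ⌋) ≡ true

  sum-indicator : ∀ N a (X : A → Bool) → (X a ≡ true → InRange N a) → sum N (λ x → ⌊ x ≟ a ⌋ ∧ X x) ≡ X a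
  sum-indicator N a X bounded = begin
      sum N (λ x → ⌊ x ≟ a ⌋ ∧ X x)
    ≡⟨ sum-cong N at ⟩
      sum N (λ x → X a ∧ ⌊ x ≟ a ⌋)
    ≡⟨ sym (∧-distribˡ-sum N (X a) _) ⟩
      X a ∧ sum N (λ x → ⌊ x ≟ a ⌋)
    ≡⟨ count (X a) refl ⟩
      X a ∎
    where
    open ≡-Reasoning
    at : ∀ x → ⌊ x ≟ a ⌋ ∧ X x ≡ X a ∧ ⌊ x ≟ a ⌋
    at x with x ≟ a
    ... | yes refl = ∧-comm true (X x)
    ... | no  _    = sym (∧-zeroʳ (X a))
    count : ∀ b → X a ≡ b → b ∧ sum N (λ x → ⌊ x ≟ a ⌋) ≡ b
    count false _   = refl
    count true  Xa = sum-≟ N a (bounded Xa)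

  -- Both sides equal the sum over y of F y times the parity of the number of preimages of y in range.
  sum-reindex : ∀ M N (F : A → Bool) (φ : A → A) →
                (∀ y → F y ≡ true → InRange N y) →
                (∀ y → F y ≡ true → Σ A λ x → InRange M x × φ x ≡ y × (∀ x′ → φ x′ ≡ y → x′ ≡ x)) →
                sum M (λ x → F (φ x)) ≡ sum N F
  sum-reindex M N F φ bounded preimage = begin
      sum M (λ x → F (φ x))
    ≡⟨ sum-cong M (λ x → sym (sum-indicator N (φ x) F (bounded (φ x)))) ⟩
      sum M (λ x → sum N (λ y → ⌊ y ≟ φ x ⌋ ∧ F y))
    ≡⟨ sum-swap M N (λ x y → ⌊ y ≟ φ x ⌋ ∧ F y) ⟩
      sum N (λ y → sum M (λ x → ⌊ y ≟ φ x ⌋ ∧ F y))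
    ≡⟨ sum-cong N (λ y → trans (sum-cong M (λ x → ∧-comm _ (F y))) (sym (∧-distribˡ-sum M (F y) _))) ⟩
      sum N (λ y → F y ∧ sum M (λ x → ⌊ y ≟ φ x ⌋))
    ≡⟨ sum-cong N (λ y → counted y (F y) refl) ⟩
      sum N F ∎
    where
    open ≡-Reasoning
    counted : ∀ y b → F y ≡ b → b ∧ sum M (λ x → ⌊ y ≟ φ x ⌋) ≡ b
    counted y false _  = refl
    counted y true  Fy with preimage y Fy
    ... | x₀ , x₀-in-range , φx₀≡y , unique = trans
          (sum-cong M (λ x → ⌊⌋-⇔ (y ≟ φ x) (x ≟ x₀) (λ y≡φx → unique x (sym y≡φx)) (λ { refl → sym φx₀≡y })))
          (sum-≟ M x₀ x₀-in-range)

ℤ-xorSums : XorSums ℤ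
ℤ-xorSums = record
  { _≟_ = ℤ._≟_ ; InRange = λ N p → ∣ p ∣ ≤ N ; sum = xsumℤ
  ; sum-cong = λ N eq → xsumℤ-cong N (λ p _ → eq p)
  ; ∧-distribˡ-sum = ∧-distribˡ-xsumℤ
  ; sum-swap = xsumℤ-swap
  ; sum-≟ = xsumℤ-≟ }

xsumℤ² : ℕ → (ℤ × ℤ → Bool) → Bool
xsumℤ² N f = xsumℤ N (λ u → xsumℤ N (λ v → f (u , v)))

_≟²_ : DecidableEquality (ℤ × ℤ)
_≟²_ = ≡-dec ℤ._≟_ ℤ._≟_

⌊≟²⌋ : ∀ u v a b → ⌊ (u , v) ≟² (a , b) ⌋ ≡ ⌊ u ℤ.≟ a ⌋ ∧ ⌊ v ℤ.≟ b ⌋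
⌊≟²⌋ u v a b = split ((u , v) ≟² (a , b)) (u ℤ.≟ a) (v ℤ.≟ b)
  where
  split : (d : Dec ((u , v) ≡ (a , b))) (u? : Dec (u ≡ a)) (v? : Dec (v ≡ b)) → ⌊ d ⌋ ≡ ⌊ u? ⌋ ∧ ⌊ v? ⌋
  split d (yes refl) (yes refl) = ⌊⌋-true d refl
  split d (yes _)    (no v≢b)   = ⌊⌋-false d (λ eq → v≢b (proj₂ (,-injective eq)))
  split d (no u≢a)   _          = ⌊⌋-false d (λ eq → u≢a (proj₁ (,-injective eq)))

ℤ²-xorSums : XorSums (ℤ × ℤ)
ℤ²-xorSums = record
  { _≟_ = _≟²_ ; InRange = λ N (u , v) → ∣ u ∣ ≤ N × ∣ v ∣ ≤ N ; sum = xsumℤ²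
  ; sum-cong = λ N eq → xsumℤ-cong N (λ u _ → xsumℤ-cong N (λ v _ → eq (u , v)))
  ; ∧-distribˡ-sum = λ N b f → trans (∧-distribˡ-xsumℤ N b _) (xsumℤ-cong N (λ u _ → ∧-distribˡ-xsumℤ N b _))
  ; sum-swap = swap
  ; sum-≟ = count }
  where
  swap : ∀ M N (h : ℤ × ℤ → ℤ × ℤ → Bool) →
         xsumℤ² M (λ x → xsumℤ² N (h x)) ≡ xsumℤ² N (λ y → xsumℤ² M (λ x → h x y))
  swap M N h = begin
      xsumℤ M (λ u → xsumℤ M (λ v → xsumℤ N (λ p → xsumℤ N (λ q → h (u , v) (p , q)))))
    ≡⟨ xsumℤ-cong M (λ u _ → xsumℤ-swap M N _) ⟩
      xsumℤ M (λ u → xsumℤ N (λ p → xsumℤ M (λ v → xsumℤ N (λ q → h (u , v) (p , q)))))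
    ≡⟨ xsumℤ-swap M N _ ⟩
      xsumℤ N (λ p → xsumℤ M (λ u → xsumℤ M (λ v → xsumℤ N (λ q → h (u , v) (p , q)))))
    ≡⟨ xsumℤ-cong N (λ p _ → xsumℤ-cong M (λ u _ → xsumℤ-swap M N _)) ⟩
      xsumℤ N (λ p → xsumℤ M (λ u → xsumℤ N (λ q → xsumℤ M (λ v → h (u , v) (p , q)))))
    ≡⟨ xsumℤ-cong N (λ p _ → xsumℤ-swap M N _) ⟩
      xsumℤ N (λ p → xsumℤ N (λ q → xsumℤ M (λ u → xsumℤ M (λ v → h (u , v) (p , q))))) ∎
    where open ≡-Reasoning
  count : ∀ N ((a , b) : ℤ × ℤ) → ∣ a ∣ ≤ N × ∣ b ∣ ≤ N → xsumℤ² N (λ x → ⌊ x ≟² (a , b) ⌋) ≡ true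
  count N (a , b) (∣a∣≤N , ∣b∣≤N) = begin
      xsumℤ N (λ u → xsumℤ N (λ v → ⌊ (u , v) ≟² (a , b) ⌋))
    ≡⟨ xsumℤ-cong N (λ u _ → trans (xsumℤ-cong N (λ v _ → ⌊≟²⌋ u v a b)) (sym (∧-distribˡ-xsumℤ N _ _))) ⟩
      xsumℤ N (λ u → ⌊ u ℤ.≟ a ⌋ ∧ xsumℤ N (λ v → ⌊ v ℤ.≟ b ⌋))
    ≡⟨ xsumℤ-cong N (λ u _ → cong (⌊ u ℤ.≟ a ⌋ ∧_) (xsumℤ-≟ N b ∣b∣≤N)) ⟩
      xsumℤ N (λ u → ⌊ u ℤ.≟ a ⌋ ∧ true)
    ≡⟨ xsumℤ-cong N (λ u _ → ∧-identityʳ _) ⟩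
      xsumℤ N (λ u → ⌊ u ℤ.≟ a ⌋)
    ≡⟨ xsumℤ-≟ N a ∣a∣≤N ⟩
      true ∎
    where open ≡-Reasoning

-- Squares and residues

sq : ℤ → ℕ
sq p = ∣ p ∣ * ∣ p ∣

+sq : ∀ p → + sq p ≡ p ℤ.* p
+sq p = sym (trans (cong (ℤ._◃ sq p) (s*s≡+ (ℤ.sign p))) (ℤₚ.+◃n≡+n (sq p)))

∣p∣≤sq : ∀ p → ∣ p ∣ ≤ sq p
∣p∣≤sq p with ∣ p ∣
... | zero  = z≤n
... | suc n = ℕₚ.m≤m*n (suc n) (suc n)

Multiple : ℕ → ℤ → Set
Multiple d x = Σ ℤ λ t → x ≡ t ℤ.* + d

multiple⇒%ℕ≡0 : ∀ d .{{_ : NonZero d}} x → Multiple d x → x %ℕ d ≡ 0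
multiple⇒%ℕ≡0 d x (t , x≡) = %ℕ-unique d x 0 t (ℕ.>-nonZero⁻¹ d) (trans x≡ (sym (ℤₚ.+-identityˡ (t ℤ.* + d))))

%ℕ≡0⇒multiple : ∀ d .{{_ : NonZero d}} x → x %ℕ d ≡ 0 → Multiple d x
%ℕ≡0⇒multiple d x x%d≡0 = x /ℕ d , trans (a≡a%ℕn+[a/ℕn]*n x d)
  (trans (cong (λ r → + r ℤ.+ x /ℕ d ℤ.* + d) x%d≡0) (ℤₚ.+-identityˡ _))

inClass : ℤ → ℤ → Bool
inClass i p = ⌊ (p ℤ.- i) %ℕ 7 ℕ.≟ 0 ⌋

inClass⇒multiple : ∀ i p → inClass i p ≡ true → Multiple 7 (p ℤ.- i)
inClass⇒multiple i p eq = %ℕ≡0⇒multiple 7 (p ℤ.- i) (⌊⌋-sound ((p ℤ.- i) %ℕ 7 ℕ.≟ 0) eq)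

multiple⇒inClass : ∀ i p → Multiple 7 (p ℤ.- i) → inClass i p ≡ true
multiple⇒inClass i p m = ⌊⌋-true ((p ℤ.- i) %ℕ 7 ℕ.≟ 0) (multiple⇒%ℕ≡0 7 (p ℤ.- i) m)

ℤ-parity : ∀ p → Σ ℤ λ w → p ≡ w ℤ.* + 2 ⊎ p ≡ w ℤ.* + 2 ℤ.+ + 1
ℤ-parity p with p %ℕ 2 | n%ℕd<d p 2 | a≡a%ℕn+[a/ℕn]*n p 2
... | 0 | _ | p≡ = p /ℕ 2 , inj₁ (trans p≡ (ℤₚ.+-identityˡ (p /ℕ 2 ℤ.* + 2)))
... | 1 | _ | p≡ = p /ℕ 2 , inj₂ (trans p≡ (ℤₚ.+-comm (+ 1) (p /ℕ 2 ℤ.* + 2)))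
... | suc (suc _) | s≤s (s≤s ()) | _

sq%4 : ∀ p → (sq p % 4 ≡ 0 × Multiple 2 p) ⊎ sq p % 4 ≡ 1
sq%4 p with ℤ-parity p
... | w , inj₁ p≡2w = inj₁ (multiple⇒%ℕ≡0 4 (+ sq p) (w ℤ.* w , p²≡) , (w , p≡2w))
  where
  open ℤ-Solver.+-*-Solver
  p²≡ : + sq p ≡ (w ℤ.* w) ℤ.* + 4
  p²≡ = trans (+sq p) (trans (cong (λ z → z ℤ.* z) p≡2w)
          (solve 1 (λ w → (w :* con (+ 2)) :* (w :* con (+ 2)) := (w :* w) :* con (+ 4)) refl w))
... | w , inj₂ p≡2w+1 = inj₂ (%ℕ-unique 4 (+ sq p) 1 (w ℤ.* w ℤ.+ w) (s≤s (s≤s z≤n)) p²≡)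
  where
  open ℤ-Solver.+-*-Solver
  p²≡ : + sq p ≡ + 1 ℤ.+ (w ℤ.* w ℤ.+ w) ℤ.* + 4
  p²≡ = trans (+sq p) (trans (cong (λ z → z ℤ.* z) p≡2w+1)
          (solve 1 (λ w → (w :* con (+ 2) :+ con (+ 1)) :* (w :* con (+ 2) :+ con (+ 1))
                          := con (+ 1) :+ (w :* w :+ w) :* con (+ 4)) refl w))

sq≢2,3-mod4 : ∀ p → sq p % 4 ≢ 2 × sq p % 4 ≢ 3
sq≢2,3-mod4 p with sq p % 4 | sq%4 p
... | .0 | inj₁ (refl , _) = (λ ()) , (λ ())
... | .1 | inj₂ refl       = (λ ()) , (λ ())

-- p² + q² ≡ p + q (mod 2).
sumOfSquares-even : ∀ p q m → sq p + sq q ≡ m + m → Multiple 2 (p ℤ.+ q)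
sumOfSquares-even p q m p²+q²≡ with ℤ-parity (p ℤ.+ q)
... | w , inj₁ p+q≡2w   = w , p+q≡2w
... | w , inj₂ p+q≡2w+1 =
  ⊥-elim (0≢1 (trans (sym (multiple⇒%ℕ≡0 2 z (+ m ℤ.+ p ℤ.* q , z-even)))
                     (%ℕ-unique 2 z 1 (w ℤ.* w ℤ.* + 2 ℤ.+ w ℤ.* + 2) (s≤s (s≤s z≤n)) z-odd)))
  where
  open ℤ-Solver.+-*-Solver
  0≢1 : 0 ≢ 1
  0≢1 ()
  z = (p ℤ.+ q) ℤ.* (p ℤ.+ q)
  p²+q² : p ℤ.* p ℤ.+ q ℤ.* q ≡ + m ℤ.+ + m
  p²+q² = trans (cong₂ ℤ._+_ (sym (+sq p)) (sym (+sq q)))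
            (trans (sym (ℤₚ.pos-+ (sq p) (sq q))) (trans (cong +_ p²+q²≡) (ℤₚ.pos-+ m m)))
  z-even : z ≡ (+ m ℤ.+ p ℤ.* q) ℤ.* + 2
  z-even = trans (solve 2 (λ p q → (p :+ q) :* (p :+ q) := (p :* p :+ q :* q) :+ (p :* q) :* con (+ 2)) refl p q)
           (trans (cong (λ u → u ℤ.+ (p ℤ.* q) ℤ.* + 2) p²+q²)
           (solve 3 (λ m p q → (m :+ m) :+ (p :* q) :* con (+ 2) := (m :+ p :* q) :* con (+ 2)) refl (+ m) p q))
  z-odd : z ≡ + 1 ℤ.+ (w ℤ.* w ℤ.* + 2 ℤ.+ w ℤ.* + 2) ℤ.* + 2
  z-odd = trans (cong (λ u → u ℤ.* u) p+q≡2w+1)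
            (solve 1 (λ w → (w :* con (+ 2) :+ con (+ 1)) :* (w :* con (+ 2) :+ con (+ 1))
                            := con (+ 1) :+ (w :* w :* con (+ 2) :+ w :* con (+ 2)) :* con (+ 2)) refl w)

-- The series [i]

theta-xsumℤ : ∀ i m → theta i m ≡ xsumℤ m (λ p → inClass i p ∧ ⌊ sq p ℕ.≟ m ⌋)
theta-xsumℤ i m = trans (xsum-intRange m _) (xsumℤ-cong m (λ p _ → cong (inClass i p ∧_)
  (⌊⌋-⇔ (p ℤ.* p ℤ.≟ + m) (sq p ℕ.≟ m) (λ eq → ℤₚ.+-injective (trans (+sq p) eq)) (λ eq → trans (sym (+sq p)) (cong +_ eq)))))

theta-xsumℤ-≤ : ∀ i k N → k ≤ N → theta i k ≡ xsumℤ N (λ p → inClass i p ∧ ⌊ sq p ℕ.≟ k ⌋)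
theta-xsumℤ-≤ i k N k≤N = trans (theta-xsumℤ i k) (sym (xsumℤ-extend k N _ k≤N outside))
  where
  outside : ∀ p → k < ∣ p ∣ → inClass i p ∧ ⌊ sq p ℕ.≟ k ⌋ ≡ false
  outside p k<∣p∣ = trans (cong (inClass i p ∧_)
    (⌊⌋-false (sq p ℕ.≟ k) (λ { refl → ℕₚ.<-irrefl refl (ℕₚ.<-≤-trans k<∣p∣ (∣p∣≤sq p)) }))) (∧-zeroʳ _)

theta-nonsquare : ∀ i m → (∀ p → sq p ≢ m) → theta i m ≡ false
theta-nonsquare i m nonsquare = trans (theta-xsumℤ i m)
  (xsumℤ-false m (λ p _ → trans (cong (inClass i p ∧_) (⌊⌋-false (sq p ℕ.≟ m) (nonsquare p))) (∧-zeroʳ _)))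

xsumBelow-convolution-indicators : ∀ n a b x y →
  xsumBelow (suc n) (λ k → (x ∧ ⌊ a ℕ.≟ k ⌋) ∧ (y ∧ ⌊ b ℕ.≟ n ∸ k ⌋)) ≡ (x ∧ y) ∧ ⌊ a + b ℕ.≟ n ⌋
xsumBelow-convolution-indicators n a b x y = begin
    xsumBelow (suc n) (λ k → (x ∧ ⌊ a ℕ.≟ k ⌋) ∧ (y ∧ ⌊ b ℕ.≟ n ∸ k ⌋))
  ≡⟨ xsumBelow-cong (suc n) (λ k _ → trans (rearrange x ⌊ a ℕ.≟ k ⌋ y ⌊ b ℕ.≟ n ∸ k ⌋) (cong (_∧ ((x ∧ y) ∧ ⌊ b ℕ.≟ n ∸ k ⌋)) (⌊⌋-⇔ (a ℕ.≟ k) (k ℕ.≟ a) sym sym))) ⟩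
    xsumBelow (suc n) (λ k → ⌊ k ℕ.≟ a ⌋ ∧ ((x ∧ y) ∧ ⌊ b ℕ.≟ n ∸ k ⌋))
  ≡⟨ xsumBelow-indicator (suc n) a (λ k → (x ∧ y) ∧ ⌊ b ℕ.≟ n ∸ k ⌋) ⟩
    ⌊ a <? suc n ⌋ ∧ ((x ∧ y) ∧ ⌊ b ℕ.≟ n ∸ a ⌋)
  ≡⟨ at-a (a <? suc n) ⟩
    (x ∧ y) ∧ ⌊ a + b ℕ.≟ n ⌋ ∎
  where
  open ≡-Reasoning
  rearrange : ∀ x d y e → (x ∧ d) ∧ (y ∧ e) ≡ d ∧ ((x ∧ y) ∧ e)
  rearrange false d y e = sym (∧-zeroʳ d)
  rearrange true  d false e = refl
  rearrange true  d true  e = refl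
  at-a : (a<n+1 : Dec (a < suc n)) → ⌊ a<n+1 ⌋ ∧ ((x ∧ y) ∧ ⌊ b ℕ.≟ n ∸ a ⌋) ≡ (x ∧ y) ∧ ⌊ a + b ℕ.≟ n ⌋
  at-a (yes a<n+1) = cong ((x ∧ y) ∧_) (⌊⌋-⇔ (b ℕ.≟ n ∸ a) (a + b ℕ.≟ n)
    (λ eq → trans (cong (a ℕ.+_) eq) (ℕₚ.m+[n∸m]≡n (ℕₚ.≤-pred a<n+1)))
    (λ eq → trans (sym (ℕₚ.m+n∸m≡n a b)) (cong (_∸ a) eq)))
  at-a (no a≮n+1) = sym (trans (cong ((x ∧ y) ∧_) (⌊⌋-false (a + b ℕ.≟ n)
    (λ eq → a≮n+1 (s≤s (subst (a ≤_) eq (ℕₚ.m≤m+n a b)))))) (∧-zeroʳ _))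

theta-*PS-theta : ∀ i j n → (theta i *PS theta j) n ≡
  xsumℤ² n (λ (p , q) → (inClass i p ∧ inClass j q) ∧ ⌊ sq p + sq q ℕ.≟ n ⌋)
theta-*PS-theta i j n = begin
    (theta i *PS theta j) n
  ≡⟨ *PS-coeff (theta i) (theta j) n ⟩
    xsumBelow (suc n) (λ k → theta i k ∧ theta j (n ∸ k))
  ≡⟨ xsumBelow-cong (suc n) (λ k k<n+1 →
       cong₂ _∧_ (theta-xsumℤ-≤ i k n (ℕₚ.≤-pred k<n+1)) (theta-xsumℤ-≤ j (n ∸ k) n (ℕₚ.m∸n≤m n k))) ⟩
    xsumBelow (suc n) (λ k → xsumℤ n (λ p → A p k) ∧ xsumℤ n (λ q → B q k))
  ≡⟨ xsumBelow-cong (suc n) (λ k _ → trans (∧-distribʳ-xsumℤ n (λ p → A p k) _)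
                                          (xsumℤ-cong n (λ p _ → ∧-distribˡ-xsumℤ n (A p k) (λ q → B q k)))) ⟩
    xsumBelow (suc n) (λ k → xsumℤ n (λ p → xsumℤ n (λ q → A p k ∧ B q k)))
  ≡⟨ sym (xsumℤ-xsumBelow n (suc n) (λ p k → xsumℤ n (λ q → A p k ∧ B q k))) ⟩
    xsumℤ n (λ p → xsumBelow (suc n) (λ k → xsumℤ n (λ q → A p k ∧ B q k)))
  ≡⟨ xsumℤ-cong n (λ p _ → sym (xsumℤ-xsumBelow n (suc n) (λ q k → A p k ∧ B q k))) ⟩
    xsumℤ n (λ p → xsumℤ n (λ q → xsumBelow (suc n) (λ k → A p k ∧ B q k)))
  ≡⟨ xsumℤ-cong n (λ p _ → xsumℤ-cong n (λ q _ → xsumBelow-convolution-indicators n (sq p) (sq q) (inClass i p) (inClass j q))) ⟩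
    xsumℤ n (λ p → xsumℤ n (λ q → (inClass i p ∧ inClass j q) ∧ ⌊ sq p + sq q ℕ.≟ n ⌋)) ∎
  where
  open ≡-Reasoning
  A : ℤ → ℕ → Bool
  A p k = inClass i p ∧ ⌊ sq p ℕ.≟ k ⌋
  B : ℤ → ℕ → Bool
  B q k = inClass j q ∧ ⌊ sq q ℕ.≟ n ∸ k ⌋

theta-exponents-mod4 : ∀ i n → theta i n ≡ true → n % 4 ≡ 0 ⊎ n % 4 ≡ 1
theta-exponents-mod4 i n θₙ with n % 4 in n%4 | m%n<n n 4
... | 0 | _ = inj₁ refl
... | 1 | _ = inj₂ refl
... | 2 | _ with () ← trans (sym θₙ) (theta-nonsquare i n (λ p eq → proj₁ (sq≢2,3-mod4 p) (trans (cong (_% 4) eq) n%4)))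
... | 3 | _ with () ← trans (sym θₙ) (theta-nonsquare i n (λ p eq → proj₂ (sq≢2,3-mod4 p) (trans (cong (_% 4) eq) n%4)))
... | suc (suc (suc (suc _))) | s≤s (s≤s (s≤s (s≤s ())))

select₂₁-theta-supportedIn : ∀ i → SupportedIn 4 1 (select 2 1 (theta i))
select₂₁-theta-supportedIn i n eq with ∧-true eq
... | n-odd , θₙ with theta-exponents-mod4 i n θₙ
...   | inj₂ n%4≡1 = n%4≡1
...   | inj₁ n%4≡0 with () ← trans (sym (⌊⌋-sound (n % 2 ℕ.≟ 1) n-odd))
                              (trans (sym (m∣n⇒o%n%m≡o%m 2 4 n (divides 2 refl))) (cong (_% 2) n%4≡0))

sq-double : ∀ q → sq (q ℤ.* + 2) ≡ 4 * sq q
sq-double q = ℤₚ.+-injective (trans (+sq (q ℤ.* + 2))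
  (trans (solve 1 (λ q → (q :* con (+ 2)) :* (q :* con (+ 2)) := con (+ 4) :* (q :* q)) refl q)
  (trans (cong (+ 4 ℤ.*_) (sym (+sq q))) (sym (ℤₚ.pos-* 4 (sq q))))))
  where open ℤ-Solver.+-*-Solver

inClass-double : ∀ i q → inClass i (q ℤ.* + 2) ≡ inClass (+ 4 ℤ.* i) q
inClass-double i q = Bool-ext
  (λ eq → multiple⇒inClass (+ 4 ℤ.* i) q (halve (inClass⇒multiple i (q ℤ.* + 2) eq)))
  (λ eq → multiple⇒inClass i (q ℤ.* + 2) (double (inClass⇒multiple (+ 4 ℤ.* i) q eq)))
  where
  open ℤ-Solver.+-*-Solver
  halve : Multiple 7 (q ℤ.* + 2 ℤ.- i) → Multiple 7 (q ℤ.- + 4 ℤ.* i)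
  halve (t , eq) = + 4 ℤ.* t ℤ.- q ,
    trans (solve 2 (λ q i → q :- con (+ 4) :* i := con (+ 4) :* (q :* con (+ 2) :- i) :- con (+ 7) :* q) refl q i)
    (trans (cong (λ z → + 4 ℤ.* z ℤ.- + 7 ℤ.* q) eq)
    (solve 2 (λ t q → con (+ 4) :* (t :* con (+ 7)) :- con (+ 7) :* q := (con (+ 4) :* t :- q) :* con (+ 7)) refl t q))
  double : Multiple 7 (q ℤ.- + 4 ℤ.* i) → Multiple 7 (q ℤ.* + 2 ℤ.- i)
  double (t , eq) = + 2 ℤ.* t ℤ.+ i ,
    trans (solve 2 (λ q i → q :* con (+ 2) :- i := con (+ 2) :* (q :- con (+ 4) :* i) :+ con (+ 7) :* i) refl q i)
    (trans (cong (λ z → + 2 ℤ.* z ℤ.+ + 7 ℤ.* i) eq)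
    (solve 2 (λ t i → con (+ 2) :* (t :* con (+ 7)) :+ con (+ 7) :* i := (con (+ 2) :* t :+ i) :* con (+ 7)) refl t i))

-- n ↦ 2n is a bijection from {n ≡ 4i (mod 7), n² = l} onto {n ≡ i (mod 7), n² = 4l}.
theta-4* : ∀ i l → theta i (4 * l) ≡ theta (+ 4 ℤ.* i) l
theta-4* i l = begin
    theta i (4 * l)
  ≡⟨ theta-xsumℤ i (4 * l) ⟩
    xsumℤ (4 * l) X
  ≡⟨ sym (XorSums.sum-reindex ℤ-xorSums l (4 * l) X (ℤ._* + 2) bounded preimage) ⟩
    xsumℤ l (λ q → X (q ℤ.* + 2))
  ≡⟨ xsumℤ-cong l (λ q _ → cong₂ _∧_ (inClass-double i q)
       (trans (cong (λ s → ⌊ s ℕ.≟ 4 * l ⌋) (sq-double q)) (⌊⌋-⇔ (4 * sq q ℕ.≟ 4 * l) (sq q ℕ.≟ l) (ℕₚ.*-cancelˡ-≡ (sq q) l 4) (cong (4 *_))))) ⟩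
    xsumℤ l (λ q → inClass (+ 4 ℤ.* i) q ∧ ⌊ sq q ℕ.≟ l ⌋)
  ≡⟨ sym (theta-xsumℤ (+ 4 ℤ.* i) l) ⟩
    theta (+ 4 ℤ.* i) l ∎
  where
  open ≡-Reasoning
  X : ℤ → Bool
  X p = inClass i p ∧ ⌊ sq p ℕ.≟ 4 * l ⌋
  sq≡ : ∀ p → X p ≡ true → sq p ≡ 4 * l
  sq≡ p Xp = ⌊⌋-sound (sq p ℕ.≟ 4 * l) (proj₂ (∧-true Xp))
  bounded : ∀ p → X p ≡ true → ∣ p ∣ ≤ 4 * l
  bounded p Xp = subst (∣ p ∣ ≤_) (sq≡ p Xp) (∣p∣≤sq p)
  preimage : ∀ p → X p ≡ true → Σ ℤ λ q → ∣ q ∣ ≤ l × q ℤ.* + 2 ≡ p × (∀ q′ → q′ ℤ.* + 2 ≡ p → q′ ≡ q)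
  preimage p Xp with sq%4 p
  ... | inj₂ p²%4≡1 with () ← trans (sym p²%4≡1) (trans (cong (_% 4) (trans (sq≡ p Xp) (ℕₚ.*-comm 4 l))) (m*n%n≡0 l 4))
  ... | inj₁ (_ , w , p≡2w) = w , ∣w∣≤l , sym p≡2w , λ q′ eq → ℤₚ.*-cancelʳ-≡ q′ w (+ 2) (trans eq p≡2w)
    where
    ∣w∣≤l : ∣ w ∣ ≤ l
    ∣w∣≤l = subst (∣ w ∣ ≤_) (ℕₚ.*-cancelˡ-≡ (sq w) l 4 (trans (sym (sq-double w)) (trans (cong sq (sym p≡2w)) (sq≡ p Xp)))) (∣p∣≤sq w)

select₂₀-theta : ∀ i → select 2 0 (theta (+ i)) ≐ stretch (stretch (theta (+ (4 * i))))
select₂₀-theta i = select₂₀≐stretch _ _ even-coeff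
  where
  even-coeff : ∀ k → theta (+ i) (2 * k) ≡ stretch (theta (+ (4 * i))) k
  even-coeff k with parity k
  ... | even l = begin
      theta (+ i) (2 * (2 * l))
    ≡⟨ cong (theta (+ i)) (sym (ℕₚ.*-assoc 2 2 l)) ⟩
      theta (+ i) (4 * l)
    ≡⟨ theta-4* (+ i) l ⟩
      theta (+ 4 ℤ.* + i) l
    ≡⟨ cong (λ j → theta j l) (sym (ℤₚ.pos-* 4 i)) ⟩
      theta (+ (4 * i)) l
    ≡⟨ sym (stretch-even (theta (+ (4 * i))) l) ⟩
      stretch (theta (+ (4 * i))) (2 * l) ∎
    where open ≡-Reasoning
  ... | odd l = trans (theta-nonsquare (+ i) n (λ p eq → proj₁ (sq≢2,3-mod4 p) (trans (cong (_% 4) eq) n%4≡2)))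
                      (sym (stretch-odd (theta (+ (4 * i))) l))
    where
    n = 2 * suc (2 * l)
    n%4≡2 : n % 4 ≡ 2
    n%4≡2 = trans (cong (_% 4) (trans (ℕₚ.*-suc 2 (2 * l)) (cong (2 ℕ.+_) (trans (sym (ℕₚ.*-assoc 2 2 l)) (ℕₚ.*-comm 4 l)))))
                  ([m+kn]%n≡m%n 2 l 4)

inClass-rotate : ∀ i u v → inClass i u ∧ inClass (+ 2 ℤ.* i) v ≡ inClass i (v ℤ.- u) ∧ inClass (+ 4 ℤ.* i) (ℤ.- u ℤ.- v)
inClass-rotate i u v = Bool-ext forward backward
  where
  open ℤ-Solver.+-*-Solver
  forward : inClass i u ∧ inClass (+ 2 ℤ.* i) v ≡ true → inClass i (v ℤ.- u) ∧ inClass (+ 4 ℤ.* i) (ℤ.- u ℤ.- v) ≡ true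
  forward eq with inClass⇒multiple i u (proj₁ (∧-true eq)) | inClass⇒multiple (+ 2 ℤ.* i) v (proj₂ (∧-true eq))
  ... | α , u-i≡ | β , v-2i≡ = cong₂ _∧_
    (multiple⇒inClass i (v ℤ.- u) (β ℤ.- α ,
      trans (solve 3 (λ u v i → v :- u :- i := (v :- con (+ 2) :* i) :- (u :- i)) refl u v i)
      (trans (cong₂ ℤ._-_ v-2i≡ u-i≡) (solve 2 (λ a b → b :* con (+ 7) :- a :* con (+ 7) := (b :- a) :* con (+ 7)) refl α β))))
    (multiple⇒inClass (+ 4 ℤ.* i) (ℤ.- u ℤ.- v) (ℤ.- α ℤ.- β ℤ.- i ,
      trans (solve 3 (λ u v i → :- u :- v :- con (+ 4) :* i := :- (u :- i) :- (v :- con (+ 2) :* i) :- con (+ 7) :* i) refl u v i)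
      (trans (cong₂ (λ x y → ℤ.- x ℤ.- y ℤ.- + 7 ℤ.* i) u-i≡ v-2i≡)
      (solve 3 (λ a b i → :- (a :* con (+ 7)) :- b :* con (+ 7) :- con (+ 7) :* i := (:- a :- b :- i) :* con (+ 7)) refl α β i))))
  backward : inClass i (v ℤ.- u) ∧ inClass (+ 4 ℤ.* i) (ℤ.- u ℤ.- v) ≡ true → inClass i u ∧ inClass (+ 2 ℤ.* i) v ≡ true
  backward eq with inClass⇒multiple i (v ℤ.- u) (proj₁ (∧-true eq)) | inClass⇒multiple (+ 4 ℤ.* i) (ℤ.- u ℤ.- v) (proj₂ (∧-true eq))
  ... | α , v-u-i≡ | β , -u-v-4i≡ = cong₂ _∧_ (multiple⇒inClass i u (γ , u-i≡))
    (multiple⇒inClass (+ 2 ℤ.* i) v (α ℤ.+ γ ,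
      trans (solve 3 (λ u v i → v :- con (+ 2) :* i := (v :- u :- i) :+ (u :- i)) refl u v i)
      (trans (cong₂ ℤ._+_ v-u-i≡ u-i≡) (solve 2 (λ a g → a :* con (+ 7) :+ g :* con (+ 7) := (a :+ g) :* con (+ 7)) refl α γ))))
    where
    γ = ℤ.- (+ 4) ℤ.* α ℤ.- (+ 4) ℤ.* β ℤ.- u ℤ.- (+ 3) ℤ.* i
    u-i≡ : u ℤ.- i ≡ γ ℤ.* + 7
    u-i≡ = trans (solve 3 (λ u v i → u :- i := :- con (+ 4) :* ((v :- u :- i) :+ (:- u :- v :- con (+ 4) :* i)) :- con (+ 7) :* (u :+ con (+ 3) :* i)) refl u v i)
           (trans (cong₂ (λ x y → ℤ.- + 4 ℤ.* (x ℤ.+ y) ℤ.- + 7 ℤ.* (u ℤ.+ + 3 ℤ.* i)) v-u-i≡ -u-v-4i≡)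
           (solve 4 (λ a b u i → :- con (+ 4) :* (a :* con (+ 7) :+ b :* con (+ 7)) :- con (+ 7) :* (u :+ con (+ 3) :* i)
                                 := (:- (con (+ 4)) :* a :- con (+ 4) :* b :- u :- con (+ 3) :* i) :* con (+ 7)) refl α β u i))

+sq-+ : ∀ p q → + (sq p + sq q) ≡ p ℤ.* p ℤ.+ q ℤ.* q
+sq-+ p q = trans (ℤₚ.pos-+ (sq p) (sq q)) (cong₂ ℤ._+_ (+sq p) (+sq q))

sq-rotate : ∀ u v → sq (v ℤ.- u) + sq (ℤ.- u ℤ.- v) ≡ 2 * (sq u + sq v)
sq-rotate u v = ℤₚ.+-injective (begin
    + (sq (v ℤ.- u) + sq (ℤ.- u ℤ.- v))
  ≡⟨ +sq-+ (v ℤ.- u) (ℤ.- u ℤ.- v) ⟩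
    (v ℤ.- u) ℤ.* (v ℤ.- u) ℤ.+ (ℤ.- u ℤ.- v) ℤ.* (ℤ.- u ℤ.- v)
  ≡⟨ solve 2 (λ u v → (v :- u) :* (v :- u) :+ (:- u :- v) :* (:- u :- v) := con (+ 2) :* (u :* u :+ v :* v)) refl u v ⟩
    + 2 ℤ.* (u ℤ.* u ℤ.+ v ℤ.* v)
  ≡⟨ cong (+ 2 ℤ.*_) (sym (+sq-+ u v)) ⟩
    + 2 ℤ.* + (sq u + sq v)
  ≡⟨ sym (ℤₚ.pos-* 2 (sq u + sq v)) ⟩
    + (2 * (sq u + sq v)) ∎)
  where
  open ≡-Reasoning
  open ℤ-Solver.+-*-Solver

rotate : ℤ × ℤ → ℤ × ℤ
rotate (u , v) = v ℤ.- u , ℤ.- u ℤ.- v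

∣p∣≤sq+sq : ∀ p q {n} → sq p + sq q ≡ n → ∣ p ∣ ≤ n
∣p∣≤sq+sq p q eq = ℕₚ.≤-trans (∣p∣≤sq p) (subst (sq p ≤_) eq (ℕₚ.m≤m+n (sq p) (sq q)))

∣q∣≤sq+sq : ∀ p q {n} → sq p + sq q ≡ n → ∣ q ∣ ≤ n
∣q∣≤sq+sq p q eq = ℕₚ.≤-trans (∣p∣≤sq q) (subst (sq q ≤_) eq (ℕₚ.m≤n+m (sq q) (sq p)))

-- With p + q = 2w, the preimage is (−w, p − w).
rotate-preimage : ∀ p q k → sq p + sq q ≡ 2 * k →
  Σ (ℤ × ℤ) λ x → (∣ proj₁ x ∣ ≤ k × ∣ proj₂ x ∣ ≤ k) × rotate x ≡ (p , q) × (∀ x′ → rotate x′ ≡ (p , q) → x′ ≡ x)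
rotate-preimage p q k p²+q²≡2k =
  (ℤ.- w , p ℤ.- w) , (∣p∣≤sq+sq (ℤ.- w) (p ℤ.- w) u₀²+v₀²≡k , ∣q∣≤sq+sq (ℤ.- w) (p ℤ.- w) u₀²+v₀²≡k) , rotate-x₀ , unique
  where
  open ℤ-Solver.+-*-Solver
  p+q-even = sumOfSquares-even p q k (trans p²+q²≡2k (cong (k ℕ.+_) (ℕₚ.+-identityʳ k)))
  w = proj₁ p+q-even
  p+q≡2w : p ℤ.+ q ≡ w ℤ.* + 2
  p+q≡2w = proj₂ p+q-even
  rotate-x₀ : rotate (ℤ.- w , p ℤ.- w) ≡ (p , q)
  rotate-x₀ = cong₂ _,_ (solve 2 (λ p w → (p :- w) :- (:- w) := p) refl p w)
    (trans (solve 2 (λ p w → :- (:- w) :- (p :- w) := w :* con (+ 2) :- p) refl p w)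
    (trans (cong (ℤ._- p) (sym p+q≡2w)) (solve 2 (λ p q → (p :+ q) :- p := q) refl p q)))
  u₀²+v₀²≡k : sq (ℤ.- w) + sq (p ℤ.- w) ≡ k
  u₀²+v₀²≡k = ℕₚ.*-cancelˡ-≡ _ k 2 (trans (sym (sq-rotate (ℤ.- w) (p ℤ.- w)))
                (trans (cong (λ (a , b) → sq a + sq b) rotate-x₀) p²+q²≡2k))
  unique : ∀ x′ → rotate x′ ≡ (p , q) → x′ ≡ (ℤ.- w , p ℤ.- w)
  unique (u , v) eq with ,-injective eq
  ... | v-u≡p , -u-v≡q = cong₂ _,_ u≡-w (trans (solve 2 (λ u v → v := (v :- u) :+ u) refl u v)
                                              (trans (cong (ℤ._+ u) v-u≡p) (cong (λ z → p ℤ.+ z) u≡-w)))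
    where
    u≡-w : u ≡ ℤ.- w
    u≡-w = ℤₚ.*-cancelʳ-≡ u (ℤ.- w) (+ 2)
      (trans (solve 2 (λ u v → u :* con (+ 2) := :- ((v :- u) :+ (:- u :- v))) refl u v)
      (trans (cong ℤ.-_ (cong₂ ℤ._+_ v-u≡p -u-v≡q))
      (trans (cong ℤ.-_ p+q≡2w) (solve 1 (λ w → :- (w :* con (+ 2)) := (:- w) :* con (+ 2)) refl w))))

-- rotate is a bijection from the pairs counted by the coefficient of x^k in θ_i θ_{2i}
-- onto those counted by the coefficient of x^{2k} in θ_i θ_{4i}.
theta*theta-2k : ∀ i k → (theta i *PS theta (+ 2 ℤ.* i)) k ≡ (theta i *PS theta (+ 4 ℤ.* i)) (2 * k)
theta*theta-2k i k = begin
    (theta i *PS theta (+ 2 ℤ.* i)) k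
  ≡⟨ theta-*PS-theta i (+ 2 ℤ.* i) k ⟩
    xsumℤ² k (λ (u , v) → (inClass i u ∧ inClass (+ 2 ℤ.* i) v) ∧ ⌊ sq u + sq v ℕ.≟ k ⌋)
  ≡⟨ XorSums.sum-cong ℤ²-xorSums k (λ (u , v) → cong₂ _∧_ (inClass-rotate i u v)
       (trans (⌊⌋-⇔ (sq u + sq v ℕ.≟ k) (2 * (sq u + sq v) ℕ.≟ 2 * k) (cong (2 *_)) (ℕₚ.*-cancelˡ-≡ _ k 2))
              (cong (λ s → ⌊ s ℕ.≟ 2 * k ⌋) (sym (sq-rotate u v))))) ⟩
    xsumℤ² k (λ x → F (rotate x))
  ≡⟨ XorSums.sum-reindex ℤ²-xorSums k (2 * k) F rotate
       (λ (p , q) Fpq → ∣p∣≤sq+sq p q (sum≡ p q Fpq) , ∣q∣≤sq+sq p q (sum≡ p q Fpq))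
       (λ (p , q) Fpq → rotate-preimage p q k (sum≡ p q Fpq)) ⟩
    xsumℤ² (2 * k) F
  ≡⟨ sym (theta-*PS-theta i (+ 4 ℤ.* i) (2 * k)) ⟩
    (theta i *PS theta (+ 4 ℤ.* i)) (2 * k) ∎
  where
  open ≡-Reasoning
  F : ℤ × ℤ → Bool
  F (p , q) = (inClass i p ∧ inClass (+ 4 ℤ.* i) q) ∧ ⌊ sq p + sq q ℕ.≟ 2 * k ⌋
  sum≡ : ∀ p q → F (p , q) ≡ true → sq p + sq q ≡ 2 * k
  sum≡ p q Fpq = ⌊⌋-sound (sq p + sq q ℕ.≟ 2 * k) (proj₂ (∧-true Fpq))

select₂₀-theta*theta : ∀ i → select 2 0 (theta (+ i) *PS theta (+ (4 * i))) ≐ stretch (theta (+ i) *PS theta (+ (2 * i)))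
select₂₀-theta*theta i = select₂₀≐stretch _ _ λ k → begin
    (theta (+ i) *PS theta (+ (4 * i))) (2 * k)
  ≡⟨ cong (λ j → (theta (+ i) *PS theta j) (2 * k)) (ℤₚ.pos-* 4 i) ⟩
    (theta (+ i) *PS theta (+ 4 ℤ.* + i)) (2 * k)
  ≡⟨ sym (theta*theta-2k (+ i) k) ⟩
    (theta (+ i) *PS theta (+ 2 ℤ.* + i)) k
  ≡⟨ cong (λ j → (theta (+ i) *PS theta j) k) (sym (ℤₚ.pos-* 2 i)) ⟩
    (theta (+ i) *PS theta (+ (2 * i))) k ∎
  where open ≡-Reasoning

-- Invertibility

ι-invertible : ∀ k (a : PS) → (∀ m → m < k → a m ≡ false) → a k ≡ true → Σ Laurent (λ f → ι a *L f ≈L oneL)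
ι-invertible k a below-k aₖ = laurent k (inverse u) , laurent≈Lι k (a *PS inverse u) 1ₛ (begin
    a *PS inverse u
  ≈⟨ *PS-congʳ {inverse u} a≐xᵏu ⟩
    (monomial k *PS u) *PS inverse u
  ≈⟨ *PS-assoc (monomial k) u (inverse u) ⟩
    monomial k *PS (u *PS inverse u)
  ≈⟨ *PS-congˡ {monomial k} (*PS-inverse u (trans (cong a (ℕₚ.+-identityʳ k)) aₖ)) ⟩
    monomial k *PS 1ₛ ∎)
  where
  open ≐-Reasoning
  u : PS
  u m = a (k + m)
  a≐xᵏu : a ≐ monomial k *PS u
  a≐xᵏu m with offset k m
  ... | below m<k = trans (below-k m m<k) (sym (monomial-*PS-< k u m m<k))
  ... | above m′ refl = sym (monomial-*PS-+ k u m′)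

allFalseBelow : ℕ → PS → Bool
allFalseBelow zero    a = true
allFalseBelow (suc k) a = not (a k) ∧ allFalseBelow k a

allFalseBelow-sound : ∀ k a → allFalseBelow k a ≡ true → ∀ m → m < k → a m ≡ false
allFalseBelow-sound (suc k) a eq m m<k+1 with ∧-true eq | m ℕ.≟ k
... | ¬aₖ , _ | yes refl = trans (sym (not-involutive (a m))) (cong not ¬aₖ)
... | _ , rest | no m≢k  = allFalseBelow-sound k a rest m (ℕₚ.≤∧≢⇒< (ℕₚ.≤-pred m<k+1) m≢k)

-- The lowest term of [r] is x^{r²}.
theta-invertible : ∀ r → 1 ≤ r → r ≤ 3 → Σ Laurent (λ f → ι (theta (+ r)) *L f ≈L oneL)
theta-invertible r@1 _ _ = ι-invertible (r * r) (theta (+ r)) (allFalseBelow-sound (r * r) _ refl) refl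
theta-invertible r@2 _ _ = ι-invertible (r * r) (theta (+ r)) (allFalseBelow-sound (r * r) _ refl) refl
theta-invertible r@3 _ _ = ι-invertible (r * r) (theta (+ r)) (allFalseBelow-sound (r * r) _ refl) refl
theta-invertible (suc (suc (suc (suc _)))) _ (s≤s (s≤s (s≤s ())))

theorem5p1 : (r : ℕ) → 1 ≤ r → r ≤ 3 →
    (Σ Laurent (λ f → ι (theta (+ r)) *L f ≈L oneL)) ×
    ((f : Laurent) → ι (theta (+ r)) *L f ≈L oneL →
      (proj 8 0 f ≈L (ι (theta (+ (4 * r))) ^L 8) *L (ι (theta (+ (2 * r))) ^L 8))
      × (proj 8 2 f ≈L ((ι (theta (+ r)) ^L 2) +L (ι (theta (+ (4 * r))) ^L 8)) *L (ι (theta (+ (2 * r))) ^L 8)))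
theorem5p1 r 1≤r r≤3 =
  theta-invertible r 1≤r r≤3 ,
  InverseClasses.proj-inverse (theta (+ r)) (theta (+ (4 * r))) (theta (+ (2 * r)))
    (select₂₀-theta r) (select₂₁-theta-supportedIn (+ r)) (select₂₀-theta*theta r)
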